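{- For every positive integer $n$, let $d=\gcd(5,n)$ and $\bar C_{5,n}(q)=[d]\,C_{5,n}(q)$. Then $\bar C_{5,n}(q)$ is a polynomial in $q$ that is unimodal with respect to parity. Equivalently, for every positive integer $n$, the Laurent polynomial $\mathrm{PT}_q\Big(\frac{q^d-q^{ -d}}{q-q^{ -1}}(q^2-q^{ -2})\,C_{5,n}(q^2)\,q^{ -4(n-1)}\Big)$ has nonnegative integer coefficients.
   Context: For a nonnegative integer $k$, $[k]=\frac{1-q^k}{1-q}$ and $[k]!=[k][k-1]\cdots[1]$ (with $[0]!=1$); $\begin{bmatrix} a+b\\ a\end{bmatrix}_q=\frac{[a+b]!}{[a]!\,[b]!}$. For positive integers $m,n$, $C_{m,n}(q)=\frac{1}{[m+n]}\begin{bmatrix} m+n\\ n\end{bmatrix}_q$. $\mathrm{PT}_q\sum_i a_iq^i=\sum_{i>0}a_iq^i$. A polynomial $a_0+a_1q+\dots+a_Nq^N$ is unimodal with respect to parity if both sequences $a_0,a_2,a_4,\dots$ and $a_1,a_3,a_5,\dots$ are unimodal, where a sequence $b_0,\dots,b_s$ is unimodal if $b_0\le\cdots\le b_j\ge b_{j+1}\ge\cdots\ge b_s$ for some $j$. -}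

module Defs where

open import Data.Nat as ℕ using (ℕ; zero; suc)
open import Data.Integer as ℤ using (ℤ; 0ℤ; 1ℤ)
open import Data.List using (List; []; _∷_; map; replicate; length)
open import Data.Product using (Σ; _×_)
open import Relation.Binary.PropositionalEquality using (_≡_)
open import Relation.Nullary using (¬_)

-- Polynomials in q with integer coefficients, as coefficient lists
-- a₀ ∷ a₁ ∷ … (coefficient of q^i at position i).
Poly : Set
Poly = List ℤ

coeff : Poly → ℕ → ℤ
coeff []      _       = 0ℤ
coeff (a ∷ p) zero    = a
coeff (a ∷ p) (suc k) = coeff p k

infixl 6 _+ₚ_
infixl 7 _*ₚ_
infix 4 _≈ₚ_

_+ₚ_ : Poly → Poly → Poly
[]      +ₚ q       = q
(a ∷ p) +ₚ []      = a ∷ p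
(a ∷ p) +ₚ (b ∷ q) = (a ℤ.+ b) ∷ (p +ₚ q)

scaleₚ : ℤ → Poly → Poly
scaleₚ a = map (a ℤ.*_)

_*ₚ_ : Poly → Poly → Poly
[]      *ₚ q = []
(a ∷ p) *ₚ q = scaleₚ a q +ₚ (0ℤ ∷ (p *ₚ q))

-- equality of polynomials (coefficientwise, ignoring trailing zeros)
_≈ₚ_ : Poly → Poly → Set
p ≈ₚ q = ∀ k → coeff p k ≡ coeff q k

qint : ℕ → Poly
qint k = replicate k 1ℤ

qfact : ℕ → Poly
qfact zero    = 1ℤ ∷ []
qfact (suc k) = qint (suc k) *ₚ qfact k

data Normalized : Poly → Set where
  single : ∀ {a} → ¬ (a ≡ 0ℤ) → Normalized (a ∷ [])
  cons   : ∀ {a b p} → Normalized (b ∷ p) → Normalized (a ∷ b ∷ p)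

evens : List ℤ → List ℤ
odds  : List ℤ → List ℤ
evens []      = []
evens (a ∷ p) = a ∷ odds p
odds  []      = []
odds  (a ∷ p) = evens p

Unimodal : List ℤ → Set
Unimodal b = Σ ℕ λ j →
  (∀ i → suc i ℕ.≤ j → suc i ℕ.< length b → coeff b i ℤ.≤ coeff b (suc i)) ×
  (∀ i → j ℕ.≤ i → suc i ℕ.< length b → coeff b (suc i) ℤ.≤ coeff b i)

UnimodalParity : Poly → Set
UnimodalParity p = Unimodal (evens p) × Unimodal (odds p)

module Submission where

-- Coefficient sequences are handled as formal power series ℕ → ℤ, with N k the
-- multiplication by 1 − q^k and G k the division by it.  P is the truncation of
--   c = [d]·(1−q^{n+1})(1−q^{n+2})(1−q^{n+3})(1−q^{n+4}) / ((1−q^2)(1−q^3)(1−q^4)(1−q^5)),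
-- because multiplying by (1−q)^5 turns both [5]!·c and [d][n+1]⋯[n+4] into the
-- same series.

open import Defs
open import Data.Nat using (ℕ; _≤_; _+_)
open import Data.Nat.GCD using (gcd)
open import Data.Product using (Σ; _×_)

open import Data.Nat using (zero; suc; _*_; _<_; z≤n; s≤s; _%_; _/_)
import Data.Nat.Properties as ℕP
open import Data.Nat.Induction using (<-rec)
open import Data.Nat.DivMod using (m≡m%n+[m/n]*n; m%n<n)
open import Data.Nat.Divisibility using (_∣_; _∣?_; divides; ∣⇒≤; ∣-antisym; ∣-refl)
open import Data.Nat.GCD using (gcd[m,n]∣m; gcd[m,n]∣n; gcd-greatest)
open import Data.Nat.Primality using (Prime; prime?; prime⇒irreducible)
import Data.Nat.Tactic.RingSolver as ℕSolver
open import Data.Integer using (ℤ; 0ℤ; 1ℤ; +_; +≤+)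
  renaming (_+_ to _+ᶻ_; _-_ to _-ᶻ_; _*_ to _*ᶻ_; -_ to negᶻ; _≤_ to _≤ᶻ_; _≤?_ to _≤ᶻ?_; _≟_ to _≟ᶻ_)
import Data.Integer.Properties as ℤP
open import Data.Integer.Tactic.RingSolver using (solve-∀)
open import Data.List using (List; []; _∷_; length)
open import Data.Product using (_,_)
open import Data.Sum using (_⊎_; inj₁; inj₂)
open import Data.Empty using (⊥-elim)
open import Data.Unit using (tt)
open import Relation.Nullary using (¬_; yes; no)
open import Relation.Nullary.Decidable using (toWitness; True)
open import Relation.Unary using (Decidable)
open import Relation.Binary.PropositionalEquality

split : ∀ k m → m < k ⊎ Σ ℕ (λ j → m ≡ k + j)
split zero m = inj₂ (m , refl)
split (suc k) zero = inj₁ (s≤s z≤n)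
split (suc k) (suc m) with split k m
... | inj₁ lt = inj₁ (s≤s lt)
... | inj₂ (j , e) = inj₂ (j , cong suc e)

periodic-induction : ∀ (P : ℕ → Set) p b → (∀ z → z < suc p + b → P z) →
  (∀ w → P (b + w) → P (suc p + (b + w))) → ∀ z → P z
periodic-induction P p b base step = <-rec P go
  where
  go : ∀ z → (∀ {j} → j < z → P j) → P z
  go z ih with split (suc p + b) z
  ... | inj₁ lt = base z lt
  ... | inj₂ (w , refl) = subst P (sym (ℕP.+-assoc (suc p) b w))
        (step w (ih (subst (b + w <_) (sym (ℕP.+-assoc (suc p) b w)) (s≤s (ℕP.m≤n+m (b + w) p)))))

-- Formal power series and the operators (1 − q^k)· and (1 − q^k)⁻¹·

Series : Set
Series = ℕ → ℤ

infixl 6 _⊕_ _⊖_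
infixr 4 _∙_

_⊕_ : Series → Series → Series
(f ⊕ g) m = f m +ᶻ g m

_⊖_ : Series → Series → Series
(f ⊖ g) m = f m -ᶻ g m

scaleS : ℤ → Series → Series
scaleS a f m = a *ᶻ f m

zeroS : Series
zeroS _ = 0ℤ

δ : Series
δ zero = 1ℤ
δ (suc _) = 0ℤ

mulq : Series → Series
mulq f zero = 0ℤ
mulq f (suc m) = f m

sh : ℕ → Series → Series
sh zero f = f
sh (suc k) f = mulq (sh k f)

N : ℕ → Series → Series
N k f = f ⊖ sh k f

_∙_ : {f g h : Series} → f ≗ g → g ≗ h → f ≗ h
(e1 ∙ e2) m = trans (e1 m) (e2 m)

~_ : {f g : Series} → f ≗ g → g ≗ f
(~ e) m = sym (e m)

≗refl : {f : Series} → f ≗ f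
≗refl m = refl

⊕-cong : ∀ {f f' g g'} → f ≗ f' → g ≗ g' → f ⊕ g ≗ f' ⊕ g'
⊕-cong e1 e2 m = cong₂ _+ᶻ_ (e1 m) (e2 m)

⊖-cong : ∀ {f f' g g'} → f ≗ f' → g ≗ g' → f ⊖ g ≗ f' ⊖ g'
⊖-cong e1 e2 m = cong₂ _-ᶻ_ (e1 m) (e2 m)

scaleS-cong : ∀ a {f g} → f ≗ g → scaleS a f ≗ scaleS a g
scaleS-cong a e m = cong (a *ᶻ_) (e m)

mulq-cong : ∀ {f g} → f ≗ g → mulq f ≗ mulq g
mulq-cong e zero = refl
mulq-cong e (suc m) = e m

sh-cong : ∀ k {f g} → f ≗ g → sh k f ≗ sh k g
sh-cong zero e = e
sh-cong (suc k) e = mulq-cong (sh-cong k e)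

sh-lo : ∀ k f m → m < k → sh k f m ≡ 0ℤ
sh-lo (suc k) f zero _ = refl
sh-lo (suc k) f (suc m) (s≤s m<k) = sh-lo k f m m<k

sh-hi : ∀ k f m → sh k f (k + m) ≡ f m
sh-hi zero f m = refl
sh-hi (suc k) f m = sh-hi k f m

sh-cong< : ∀ k {f g} m → (∀ j → j < m → f j ≡ g j) → sh (suc k) f m ≡ sh (suc k) g m
sh-cong< zero zero h = refl
sh-cong< zero (suc m) h = h m ℕP.≤-refl
sh-cong< (suc k) zero h = refl
sh-cong< (suc k) (suc m) h = sh-cong< k m (λ j j<m → h j (ℕP.m≤n⇒m≤1+n j<m))

sh-zeroS : ∀ k → sh k zeroS ≗ zeroS
sh-zeroS k m with split k m
... | inj₁ lt = sh-lo k zeroS m lt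
... | inj₂ (j , refl) = sh-hi k zeroS j

mulq-⊕ : ∀ f g → mulq (f ⊕ g) ≗ mulq f ⊕ mulq g
mulq-⊕ f g zero = refl
mulq-⊕ f g (suc m) = refl

mulq-⊖ : ∀ f g → mulq (f ⊖ g) ≗ mulq f ⊖ mulq g
mulq-⊖ f g zero = refl
mulq-⊖ f g (suc m) = refl

mulq-scaleS : ∀ a f → mulq (scaleS a f) ≗ scaleS a (mulq f)
mulq-scaleS a f zero = sym (ℤP.*-zeroʳ a)
mulq-scaleS a f (suc m) = refl

sh-⊕ : ∀ k f g → sh k (f ⊕ g) ≗ sh k f ⊕ sh k g
sh-⊕ zero f g = ≗refl
sh-⊕ (suc k) f g = mulq-cong (sh-⊕ k f g) ∙ mulq-⊕ (sh k f) (sh k g)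

sh-⊖ : ∀ k f g → sh k (f ⊖ g) ≗ sh k f ⊖ sh k g
sh-⊖ zero f g = ≗refl
sh-⊖ (suc k) f g = mulq-cong (sh-⊖ k f g) ∙ mulq-⊖ (sh k f) (sh k g)

sh-+ : ∀ a b f → sh (a + b) f ≗ sh a (sh b f)
sh-+ zero b f = ≗refl
sh-+ (suc a) b f = mulq-cong (sh-+ a b f)

sh-comm : ∀ a b f → sh a (sh b f) ≗ sh b (sh a f)
sh-comm a b f = ~ sh-+ a b f ∙ (λ m → cong (λ x → sh x f m) (ℕP.+-comm a b)) ∙ sh-+ b a f

N-cong : ∀ k {f g} → f ≗ g → N k f ≗ N k g
N-cong k e = ⊖-cong e (sh-cong k e)

N-congk : ∀ {a b} f → a ≡ b → N a f ≗ N b f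
N-congk f refl = ≗refl

sh-N : ∀ a k f → sh a (N k f) ≗ N k (sh a f)
sh-N a k f = sh-⊖ a f (sh k f) ∙ ⊖-cong (≗refl {sh a f}) (sh-comm a k f)

N-comm : ∀ a b f → N a (N b f) ≗ N b (N a f)
N-comm a b f m = begin
    N b f m -ᶻ sh a (N b f) m
  ≡⟨ cong (N b f m -ᶻ_) (sh-N a b f m) ⟩
    (f m -ᶻ sh b f m) -ᶻ (sh a f m -ᶻ sh b (sh a f) m)
  ≡⟨ cong (λ w → (f m -ᶻ sh b f m) -ᶻ (sh a f m -ᶻ w)) (sh-comm b a f m) ⟩
    (f m -ᶻ sh b f m) -ᶻ (sh a f m -ᶻ sh a (sh b f) m)
  ≡⟨ swap-middle (f m) (sh b f m) (sh a f m) (sh a (sh b f) m) ⟩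
    N a f m -ᶻ (sh b f m -ᶻ sh a (sh b f) m)
  ≡⟨ cong (N a f m -ᶻ_) (sym (sh-N b a f m)) ⟩
    N a f m -ᶻ sh b (N a f) m ∎
  where
  open ≡-Reasoning
  swap-middle : ∀ x y z w → (x -ᶻ y) -ᶻ (z -ᶻ w) ≡ (x -ᶻ z) -ᶻ (y -ᶻ w)
  swap-middle = solve-∀

N-⊕ : ∀ k f g → N k (f ⊕ g) ≗ N k f ⊕ N k g
N-⊕ k f g m = trans (cong ((f m +ᶻ g m) -ᶻ_) (sh-⊕ k f g m)) (lem (f m) (g m) _ _)
  where
  lem : ∀ x y z w → (x +ᶻ y) -ᶻ (z +ᶻ w) ≡ (x -ᶻ z) +ᶻ (y -ᶻ w)
  lem = solve-∀

N-⊖ : ∀ k f g → N k (f ⊖ g) ≗ N k f ⊖ N k g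
N-⊖ k f g m = trans (cong ((f m -ᶻ g m) -ᶻ_) (sh-⊖ k f g m)) (lem (f m) (g m) _ _)
  where
  lem : ∀ x y z w → (x -ᶻ y) -ᶻ (z -ᶻ w) ≡ (x -ᶻ z) -ᶻ (y -ᶻ w)
  lem = solve-∀

N-+ : ∀ a b f → N (a + b) f ≗ N b f ⊕ sh b (N a f)
N-+ a b f m = trans (cong (f m -ᶻ_) (trans (sh-+ a b f m) (sh-comm a b f m)))
  (trans (lem (f m) (sh b f m) (sh b (sh a f) m)) (cong (N b f m +ᶻ_) (sym (sh-⊖ b f (sh a f) m))))
  where
  lem : ∀ x y z → x -ᶻ z ≡ (x -ᶻ y) +ᶻ (y -ᶻ z)
  lem = solve-∀

-- For k ≥ 1, multiplication by 1 − q^k is injective: the coefficient at m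
-- is recovered from (1 − q^k) f and the coefficients of f below m.
N-inj : ∀ k f g → N (suc k) f ≗ N (suc k) g → f ≗ g
N-inj k f g e = <-rec (λ m → f m ≡ g m) step
  where
  lem : ∀ x y → x ≡ (x -ᶻ y) +ᶻ y
  lem = solve-∀
  step : ∀ m → (∀ {j} → j < m → f j ≡ g j) → f m ≡ g m
  step m h = trans (lem (f m) (sh (suc k) f m))
    (trans (cong₂ _+ᶻ_ (e m) (sh-cong< k m (λ j j<m → h j<m))) (sym (lem (g m) (sh (suc k) g m))))

-- Division by 1 − q^{k+1}: Gf k f u is the partial sum f + q^{k+1} f + … with
-- u terms, and its coefficient at m stabilises once u ≥ m.
Gf : ℕ → Series → ℕ → Series
Gf k f zero = f
Gf k f (suc u) = f ⊕ sh (suc k) (Gf k f u)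

G : ℕ → Series → Series
G zero f = f
G (suc k) f m = Gf k f m m

Gf-stable : ∀ k f u u' m → m ≤ u → m ≤ u' → Gf k f u m ≡ Gf k f u' m
Gf-stable k f zero zero m _ _ = refl
Gf-stable k f zero (suc u') zero _ _ = sym (ℤP.+-identityʳ (f 0))
Gf-stable k f (suc u) zero zero _ _ = ℤP.+-identityʳ (f 0)
Gf-stable k f (suc u) (suc u') m p q =
  cong (f m +ᶻ_) (sh-cong< k m (λ j j<m → Gf-stable k f u u' j
     (ℕP.≤-pred (ℕP.<-≤-trans j<m p)) (ℕP.≤-pred (ℕP.<-≤-trans j<m q))))

G-eq : ∀ k f m → G (suc k) f m ≡ f m +ᶻ sh (suc k) (G (suc k) f) m
G-eq k f zero = sym (ℤP.+-identityʳ (f 0))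
G-eq k f (suc m) = cong (f (suc m) +ᶻ_) (sh-cong< k (suc m)
  (λ j j<sm → Gf-stable k f m j j (ℕP.≤-pred j<sm) ℕP.≤-refl))

NG : ∀ k f → N (suc k) (G (suc k) f) ≗ f
NG k f m = trans (cong (_-ᶻ sh (suc k) (G (suc k) f) m) (G-eq k f m)) (lem (f m) _)
  where
  lem : ∀ x y → (x +ᶻ y) -ᶻ y ≡ x
  lem = solve-∀

GN : ∀ k f → G (suc k) (N (suc k) f) ≗ f
GN k f = N-inj k _ _ (NG k (N (suc k) f))

G-cong : ∀ k {f g} → f ≗ g → G (suc k) f ≗ G (suc k) g
G-cong k {f} {g} e = N-inj k _ _ (NG k f ∙ e ∙ ~ NG k g)

-- Everything that commutes with N (k+1) commutes with G (k+1).
GN-comm : ∀ k a f → G (suc k) (N a f) ≗ N a (G (suc k) f)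
GN-comm k a f = N-inj k _ _ (NG k (N a f) ∙ N-cong a (~ NG k f) ∙ N-comm a (suc k) (G (suc k) f))

GG-comm : ∀ j k f → G (suc j) (G (suc k) f) ≗ G (suc k) (G (suc j) f)
GG-comm j k f = N-inj j _ _ (N-inj k _ _
  (N-cong (suc k) (NG j (G (suc k) f)) ∙ NG k f
   ∙ ~ (N-cong (suc k) (~ GN-comm k (suc j) (G (suc j) f)) ∙ NG k (N (suc j) (G (suc j) f)) ∙ NG j f)))

G-⊖ : ∀ k f g → G (suc k) (f ⊖ g) ≗ G (suc k) f ⊖ G (suc k) g
G-⊖ k f g = N-inj k _ _ (NG k (f ⊖ g) ∙ ~ (N-⊖ (suc k) (G (suc k) f) (G (suc k) g) ∙ ⊖-cong (NG k f) (NG k g)))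

G-sh : ∀ k a f → G (suc k) (sh a f) ≗ sh a (G (suc k) f)
G-sh k a f = N-inj k _ _ (NG k (sh a f) ∙ ~ (~ sh-N a (suc k) (G (suc k) f) ∙ sh-cong a (NG k f)))

Agree : ℕ → Series → Series → Set
Agree T f g = ∀ m → m ≤ T → f m ≡ g m

G-causal : ∀ k T f g → Agree T f g → Agree T (G (suc k) f) (G (suc k) g)
G-causal k T f g ag = <-rec (λ m → m ≤ T → G (suc k) f m ≡ G (suc k) g m) step
  where
  step : ∀ m → (∀ {j} → j < m → j ≤ T → G (suc k) f j ≡ G (suc k) g j) → m ≤ T → G (suc k) f m ≡ G (suc k) g m
  step m ih le = trans (G-eq k f m)
    (trans (cong₂ _+ᶻ_ (ag m le) (sh-cong< k m (λ j j<m → ih j<m (ℕP.≤-trans (ℕP.<⇒≤ j<m) le))))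
    (sym (G-eq k g m)))

-- Polynomials acting on series by multiplication

act : Poly → Series → Series
act [] f = zeroS
act (a ∷ p) f = scaleS a f ⊕ mulq (act p f)

coeff-act : ∀ p → coeff p ≗ act p δ
coeff-act [] m = refl
coeff-act (a ∷ p) zero = sym (trans (ℤP.+-identityʳ _) (ℤP.*-identityʳ a))
coeff-act (a ∷ p) (suc m) = trans (coeff-act p m)
  (sym (trans (cong (_+ᶻ act p δ m) (ℤP.*-zeroʳ a)) (ℤP.+-identityˡ _)))

act-cong : ∀ p {f g} → f ≗ g → act p f ≗ act p g
act-cong [] e m = refl
act-cong (a ∷ p) e = ⊕-cong (scaleS-cong a e) (mulq-cong (act-cong p e))

act-+ : ∀ p q f → act (p +ₚ q) f ≗ act p f ⊕ act q f
act-+ [] q f m = sym (ℤP.+-identityˡ _)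
act-+ (a ∷ p) [] f m = sym (ℤP.+-identityʳ _)
act-+ (a ∷ p) (b ∷ q) f m =
  trans (cong ((a +ᶻ b) *ᶻ f m +ᶻ_) ((mulq-cong (act-+ p q f) ∙ mulq-⊕ (act p f) (act q f)) m))
  (lem a b (f m) _ _)
  where
  lem : ∀ a b x y z → (a +ᶻ b) *ᶻ x +ᶻ (y +ᶻ z) ≡ (a *ᶻ x +ᶻ y) +ᶻ (b *ᶻ x +ᶻ z)
  lem = solve-∀

act-scale : ∀ c q f → act (scaleₚ c q) f ≗ scaleS c (act q f)
act-scale c [] f m = sym (ℤP.*-zeroʳ c)
act-scale c (b ∷ q) f m =
  trans (cong ((c *ᶻ b) *ᶻ f m +ᶻ_) ((mulq-cong (act-scale c q f) ∙ mulq-scaleS c (act q f)) m))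
  (lem c b (f m) _)
  where
  lem : ∀ c b x y → (c *ᶻ b) *ᶻ x +ᶻ c *ᶻ y ≡ c *ᶻ (b *ᶻ x +ᶻ y)
  lem = solve-∀

act-* : ∀ p q f → act (p *ₚ q) f ≗ act p (act q f)
act-* [] q f m = refl
act-* (a ∷ p) q f m = trans (act-+ (scaleₚ a q) (0ℤ ∷ (p *ₚ q)) f m)
  (cong₂ _+ᶻ_ (act-scale a q f m) (trans (cong (_+ᶻ mulq (act (p *ₚ q) f) m) (ℤP.*-zeroˡ (f m)))
      (trans (ℤP.+-identityˡ _) (mulq-cong (act-* p q f) m))))

act-⊕ : ∀ p f g → act p (f ⊕ g) ≗ act p f ⊕ act p g
act-⊕ [] f g m = refl
act-⊕ (a ∷ p) f g m =
  trans (cong (a *ᶻ (f m +ᶻ g m) +ᶻ_) ((mulq-cong (act-⊕ p f g) ∙ mulq-⊕ (act p f) (act p g)) m))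
  (lem a (f m) (g m) _ _)
  where
  lem : ∀ a x y z w → a *ᶻ (x +ᶻ y) +ᶻ (z +ᶻ w) ≡ (a *ᶻ x +ᶻ z) +ᶻ (a *ᶻ y +ᶻ w)
  lem = solve-∀

act-⊖ : ∀ p f g → act p (f ⊖ g) ≗ act p f ⊖ act p g
act-⊖ [] f g m = refl
act-⊖ (a ∷ p) f g m =
  trans (cong (a *ᶻ (f m -ᶻ g m) +ᶻ_) ((mulq-cong (act-⊖ p f g) ∙ mulq-⊖ (act p f) (act p g)) m))
  (lem a (f m) (g m) _ _)
  where
  lem : ∀ a x y z w → a *ᶻ (x -ᶻ y) +ᶻ (z -ᶻ w) ≡ (a *ᶻ x +ᶻ z) -ᶻ (a *ᶻ y +ᶻ w)
  lem = solve-∀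

act-scaleS : ∀ p c f → act p (scaleS c f) ≗ scaleS c (act p f)
act-scaleS [] c f m = sym (ℤP.*-zeroʳ c)
act-scaleS (a ∷ p) c f m =
  trans (cong (a *ᶻ (c *ᶻ f m) +ᶻ_) ((mulq-cong (act-scaleS p c f) ∙ mulq-scaleS c (act p f)) m))
  (lem a c (f m) _)
  where
  lem : ∀ a c x y → a *ᶻ (c *ᶻ x) +ᶻ c *ᶻ y ≡ c *ᶻ (a *ᶻ x +ᶻ y)
  lem = solve-∀

act-mulq : ∀ p f → act p (mulq f) ≗ mulq (act p f)
act-mulq [] f zero = refl
act-mulq [] f (suc m) = refl
act-mulq (a ∷ p) f = ⊕-cong (~ mulq-scaleS a f) (mulq-cong (act-mulq p f)) ∙ ~ mulq-⊕ (scaleS a f) (mulq (act p f))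

act-sh : ∀ p k f → act p (sh k f) ≗ sh k (act p f)
act-sh p zero f = ≗refl
act-sh p (suc k) f = act-mulq p (sh k f) ∙ mulq-cong (act-sh p k f)

act-N : ∀ p k f → act p (N k f) ≗ N k (act p f)
act-N p k f = act-⊖ p f (sh k f) ∙ ⊖-cong (≗refl {act p f}) (act-sh p k f)

act-G : ∀ p k f → act p (G (suc k) f) ≗ G (suc k) (act p f)
act-G p k f = N-inj k _ _ (~ act-N p (suc k) (G (suc k) f) ∙ act-cong p (NG k f) ∙ ~ NG k (act p f))

act-zeroS : ∀ p → act p zeroS ≗ zeroS
act-zeroS [] m = refl
act-zeroS (a ∷ p) zero = trans (ℤP.+-identityʳ _) (ℤP.*-zeroʳ a)
act-zeroS (a ∷ p) (suc m) = cong₂ _+ᶻ_ (ℤP.*-zeroʳ a) (act-zeroS p m)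

act-comm : ∀ p q f → act p (act q f) ≗ act q (act p f)
act-comm p [] f = act-zeroS p
act-comm p (b ∷ q) f = act-⊕ p (scaleS b f) (mulq (act q f))
  ∙ ⊕-cong (act-scaleS p b f) (act-mulq p (act q f) ∙ mulq-cong (act-comm p q f))

act-qint1 : ∀ f → act (qint 1) f ≗ f
act-qint1 f zero = trans (ℤP.+-identityʳ _) (ℤP.*-identityˡ (f 0))
act-qint1 f (suc m) = trans (ℤP.+-identityʳ _) (ℤP.*-identityˡ (f (suc m)))

N1-qint : ∀ k f → N 1 (act (qint k) f) ≗ N k f
N1-qint zero f zero = sym (ℤP.+-inverseʳ (f 0))
N1-qint zero f (suc m) = sym (ℤP.+-inverseʳ (f (suc m)))
N1-qint (suc k) f = N-⊕ 1 (scaleS 1ℤ f) (mulq (act (qint k) f))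
  ∙ ⊕-cong (≗refl {N 1 (scaleS 1ℤ f)}) (~ sh-N 1 1 (act (qint k) f) ∙ mulq-cong (N1-qint k f)) ∙ telescope
  where
  lem : ∀ x y z → (1ℤ *ᶻ x -ᶻ 1ℤ *ᶻ y) +ᶻ (y -ᶻ z) ≡ x -ᶻ z
  lem = solve-∀
  lem0 : ∀ x → (1ℤ *ᶻ x -ᶻ 0ℤ) +ᶻ 0ℤ ≡ x -ᶻ 0ℤ
  lem0 = solve-∀
  telescope : N 1 (scaleS 1ℤ f) ⊕ mulq (N k f) ≗ N (suc k) f
  telescope zero = lem0 (f 0)
  telescope (suc m) = lem (f (suc m)) (f m) (sh k f m)

act-qint-nonneg : ∀ k f m → (∀ x → x ≤ m → 0ℤ ≤ᶻ f x) → 0ℤ ≤ᶻ act (qint k) f m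
act-qint-nonneg zero f m h = ℤP.≤-refl
act-qint-nonneg (suc k) f zero h =
  ℤP.+-mono-≤ (subst (0ℤ ≤ᶻ_) (sym (ℤP.*-identityˡ (f 0))) (h 0 z≤n)) ℤP.≤-refl
act-qint-nonneg (suc k) f (suc m) h =
  ℤP.+-mono-≤ (subst (0ℤ ≤ᶻ_) (sym (ℤP.*-identityˡ (f (suc m)))) (h (suc m) ℕP.≤-refl))
              (act-qint-nonneg k f m (λ x le → h x (ℕP.m≤n⇒m≤1+n le)))

-- Degree bounds and reversal

Supp : ℕ → Series → Set
Supp B f = ∀ m → B < m → f m ≡ 0ℤ

Supp-mono : ∀ {B B' f} → B ≤ B' → Supp B f → Supp B' f
Supp-mono le sp m lt = sp m (ℕP.≤-<-trans le lt)

Supp-cong : ∀ {B f g} → f ≗ g → Supp B f → Supp B g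
Supp-cong e sp m lt = trans (sym (e m)) (sp m lt)

Supp-reindex : ∀ {B B' f} → B ≡ B' → Supp B f → Supp B' f
Supp-reindex refl sp = sp

Supp-δ : Supp 0 δ
Supp-δ (suc m) _ = refl

Supp-⊕ : ∀ {B f g} → Supp B f → Supp B g → Supp B (f ⊕ g)
Supp-⊕ s1 s2 m lt = cong₂ _+ᶻ_ (s1 m lt) (s2 m lt)

Supp-sh : ∀ k {B f} → Supp B f → Supp (k + B) (sh k f)
Supp-sh k {B} {f} sp m lt with split k m
... | inj₁ m<k = sh-lo k f m m<k
... | inj₂ (j , refl) = trans (sh-hi k f j) (sp j (ℕP.+-cancelˡ-< k B j lt))

Supp-N : ∀ k {B f} → Supp B f → Supp (k + B) (N k f)
Supp-N k {B} sp m lt = cong₂ _-ᶻ_ (sp m (ℕP.≤-<-trans (ℕP.m≤n+m B k) lt)) (Supp-sh k sp m lt)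

-- rev B f is the reversal q^B f(1/q) of f, truncated to degree B.
revg : Series → ℕ → ℕ → ℤ
revg f b zero = f b
revg f zero (suc m) = 0ℤ
revg f (suc b) (suc m) = revg f b m

rev : ℕ → Series → Series
rev B f m = revg f B m

rev-pair : ∀ B f a b → a + b ≡ B → rev B f a ≡ f b
rev-pair B f zero b refl = refl
rev-pair zero f (suc a) b ()
rev-pair (suc B) f (suc a) b e = rev-pair B f a b (ℕP.suc-injective e)

rev-gt : ∀ B f m → B < m → rev B f m ≡ 0ℤ
rev-gt zero f (suc m) _ = refl
rev-gt (suc B) f (suc m) (s≤s lt) = rev-gt B f m lt

rev-ext : ∀ B f g → (∀ m u → m + u ≡ B → g m ≡ f u) → Supp B g → rev B f ≗ g
rev-ext B f g pair sp m with ℕP.≤-<-connex m B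
... | inj₂ lt = trans (rev-gt B f m lt) (sym (sp m lt))
... | inj₁ le with ℕP.m≤n⇒∃[o]m+o≡n le
... | (u , eq) = trans (rev-pair B f m u eq) (sym (pair m u eq))

rev-cong : ∀ B {f g} → f ≗ g → rev B f ≗ rev B g
rev-cong B {f} {g} e = rev-ext B f (rev B g) (λ m u eq → trans (rev-pair B g m u eq) (sym (e u))) (rev-gt B g)

rev-⊖ : ∀ B f g → rev B (f ⊖ g) ≗ rev B f ⊖ rev B g
rev-⊖ zero f g zero = refl
rev-⊖ zero f g (suc m) = refl
rev-⊖ (suc B) f g zero = refl
rev-⊖ (suc B) f g (suc m) = rev-⊖ B f g m

rev-sh : ∀ k B f → rev (k + B) (sh k f) ≗ rev B f
rev-sh k B f = rev-ext (k + B) (sh k f) (rev B f) pair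
  (λ m lt → rev-gt B f m (ℕP.≤-<-trans (ℕP.m≤n+m B k) lt))
  where
  pair : ∀ m u → m + u ≡ k + B → rev B f m ≡ sh k f u
  pair m u e with split k u
  ... | inj₁ u<k = trans (rev-gt B f m B<m) (sym (sh-lo k f u u<k))
    where
    B<m : B < m
    B<m = ℕP.+-cancelʳ-< u B m (subst₂ _<_ (ℕP.+-comm u B) (sym e) (ℕP.+-monoˡ-< B u<k))
  ... | inj₂ (v , refl) = trans (rev-pair B f m v mv) (sym (sh-hi k f v))
    where
    left-comm : ∀ a b c → a + (b + c) ≡ b + (a + c)
    left-comm = ℕSolver.solve-∀
    mv : m + v ≡ B
    mv = ℕP.+-cancelˡ-≡ k _ _ (trans (left-comm k m v) e)

rev-widen : ∀ k B f → Supp B f → rev (k + B) f ≗ sh k (rev B f)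
rev-widen k B f sp = rev-ext (k + B) f (sh k (rev B f)) pair (Supp-sh k (rev-gt B f))
  where
  pair : ∀ m u → m + u ≡ k + B → sh k (rev B f) m ≡ f u
  pair m u e with split k m
  ... | inj₁ m<k = trans (sh-lo k (rev B f) m m<k) (sym (sp u B<u))
    where
    B<u : B < u
    B<u = ℕP.+-cancelˡ-< m B u (subst (m + B <_) (sym e) (ℕP.+-monoˡ-< B m<k))
  ... | inj₂ (j , refl) = trans (sh-hi k (rev B f) j)
        (rev-pair B f j u (ℕP.+-cancelˡ-≡ k _ _ (trans (sym (ℕP.+-assoc k j u)) e)))

negS : Series → Series
negS f m = negᶻ (f m)

negS-cong : ∀ {f g} → f ≗ g → negS f ≗ negS g
negS-cong e m = cong negᶻ (e m)

N-negS : ∀ k f → N k (negS f) ≗ negS (N k f)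
N-negS k f m = trans (cong (negᶻ (f m) -ᶻ_) (sh-negS m)) (lem (f m) (sh k f m))
  where
  lem : ∀ x y → negᶻ x -ᶻ negᶻ y ≡ negᶻ (x -ᶻ y)
  lem = solve-∀
  sh-negS : sh k (negS f) ≗ negS (sh k f)
  sh-negS m with split k m
  ... | inj₁ lt = trans (sh-lo k (negS f) m lt) (sym (cong negᶻ (sh-lo k f m lt)))
  ... | inj₂ (j , refl) = trans (sh-hi k (negS f) j) (sym (cong negᶻ (sh-hi k f j)))

rev-N : ∀ k B f → Supp B f → rev (k + B) (N k f) ≗ negS (N k (rev B f))
rev-N k B f sp = rev-⊖ (k + B) f (sh k f) ∙ ⊖-cong (rev-widen k B f sp) (rev-sh k B f) ∙ flip
  where
  lem : ∀ x y → x -ᶻ y ≡ negᶻ (y -ᶻ x)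
  lem = solve-∀
  flip : sh k (rev B f) ⊖ rev B f ≗ negS (N k (rev B f))
  flip m = lem (sh k (rev B f) m) (rev B f m)

rev-NN : ∀ k k' B f → Supp B f → rev (k + (k' + B)) (N k (N k' f)) ≗ N k (N k' (rev B f))
rev-NN k k' B f sp = rev-N k (k' + B) (N k' f) (Supp-N k' sp)
  ∙ negS-cong (N-cong k (rev-N k' B f sp) ∙ N-negS k (N k' (rev B f)))
  ∙ (λ m → ℤP.neg-involutive _)

N-top : ∀ k B f → Supp B f → N (suc k) f (suc k + B) ≡ negᶻ (f B)
N-top k B f sp = trans (cong₂ _-ᶻ_ (sp (suc k + B) (s≤s (ℕP.m≤n+m B k))) (sh-hi (suc k) f B)) (ℤP.+-identityˡ _)

Den : Series → Series
Den f = N 5 (N 4 (N 3 (N 2 f)))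

div345 : Series → Series
div345 f = G 3 (G 4 (G 5 f))

divDen : Series → Series
divDen f = G 2 (div345 f)

Den-inj : ∀ f g → Den f ≗ Den g → f ≗ g
Den-inj f g e = N-inj 1 _ _ (N-inj 2 _ _ (N-inj 3 _ _ (N-inj 4 _ _ e)))

Den-divDen : ∀ f → Den (divDen f) ≗ f
Den-divDen f = N-cong 5 (N-cong 4 (N-cong 3 (NG 1 _) ∙ NG 2 _) ∙ NG 3 _) ∙ NG 4 f

rev-Den : ∀ B f → Supp B f → rev (14 + B) (Den f) ≗ Den (rev B f)
rev-Den B f sp = rev-NN 5 4 (3 + (2 + B)) (N 3 (N 2 f)) (Supp-N 3 (Supp-N 2 sp))
  ∙ N-cong 5 (N-cong 4 (rev-NN 3 2 B f sp))

palindromic-quotient : ∀ D c X → Supp D c → Den c ≗ X → rev (14 + D) X ≗ X →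
  ∀ a b → a + b ≡ D → c a ≡ c b
palindromic-quotient D c X sp eX rX a b e = trans (sym (rev-c a)) (rev-pair D c a b e)
  where
  rev-c : rev D c ≗ c
  rev-c = Den-inj _ _ (~ rev-Den D c sp ∙ rev-cong (14 + D) eX ∙ rX ∙ ~ eX)

Den-top : ∀ S c → Supp S c → Den c (14 + S) ≡ c S
Den-top S c sp = begin
    Den c (14 + S)
  ≡⟨ N-top 4 (9 + S) _ (Supp-N 4 (Supp-N 3 (Supp-N 2 sp))) ⟩
    negᶻ (N 4 (N 3 (N 2 c)) (9 + S))
  ≡⟨ cong negᶻ (N-top 3 (5 + S) _ (Supp-N 3 (Supp-N 2 sp))) ⟩
    negᶻ (negᶻ (N 3 (N 2 c) (5 + S)))
  ≡⟨ ℤP.neg-involutive _ ⟩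
    N 3 (N 2 c) (5 + S)
  ≡⟨ N-top 2 (2 + S) _ (Supp-N 2 sp) ⟩
    negᶻ (N 2 c (2 + S))
  ≡⟨ cong negᶻ (N-top 1 S c sp) ⟩
    negᶻ (negᶻ (c S))
  ≡⟨ ℤP.neg-involutive _ ⟩
    c S ∎
  where open ≡-Reasoning

Den-degree : ∀ D j c → Supp (j + D) c → Supp (14 + D) (Den c) → Supp D c
Den-degree D zero c sp sX = sp
Den-degree D (suc j) c sp sX = Den-degree D j c sp' sX
  where
  top-zero : c (suc (j + D)) ≡ 0ℤ
  top-zero = trans (sym (Den-top (suc (j + D)) c sp))
    (sX _ (ℕP.+-monoʳ-< 14 (s≤s (ℕP.m≤n+m D j))))
  sp' : Supp (j + D) c
  sp' m lt with ℕP.m≤n⇒m<n∨m≡n lt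
  ... | inj₁ lt' = sp m lt'
  ... | inj₂ refl = top-zero

-- Gaussian binomial coefficients

Poch : ℕ → ℕ → Series → Series
Poch n zero f = f
Poch n (suc k) f = N (n + suc k) (Poch n k f)

divPoch : ℕ → Series → Series
divPoch zero f = f
divPoch (suc k) f = G (suc k) (divPoch k f)

gauss : ℕ → ℕ → Series
gauss n k = divPoch k (Poch n k δ)

divPoch-cong : ∀ k {f g} → f ≗ g → divPoch k f ≗ divPoch k g
divPoch-cong zero e = e
divPoch-cong (suc k) e = G-cong k (divPoch-cong k e)

divPoch-N : ∀ k a f → divPoch k (N a f) ≗ N a (divPoch k f)
divPoch-N zero a f = ≗refl
divPoch-N (suc k) a f = G-cong k (divPoch-N k a f) ∙ GN-comm k a (divPoch k f)

Poch-G : ∀ n k j f → Poch n k (G (suc j) f) ≗ G (suc j) (Poch n k f)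
Poch-G n zero j f = ≗refl
Poch-G n (suc k) j f = N-cong (n + suc k) (Poch-G n k j f) ∙ ~ GN-comm j (n + suc k) (Poch n k f)

Poch-⊕ : ∀ n k f g → Poch n k (f ⊕ g) ≗ Poch n k f ⊕ Poch n k g
Poch-⊕ n zero f g = ≗refl
Poch-⊕ n (suc k) f g = N-cong (n + suc k) (Poch-⊕ n k f g) ∙ N-⊕ (n + suc k) (Poch n k f) (Poch n k g)

Poch-sh : ∀ n k a f → Poch n k (sh a f) ≗ sh a (Poch n k f)
Poch-sh n zero a f = ≗refl
Poch-sh n (suc k) a f = N-cong (n + suc k) (Poch-sh n k a f) ∙ ~ sh-N a (n + suc k) (Poch n k f)

Poch-N : ∀ n k a f → Poch n k (N a f) ≗ N a (Poch n k f)
Poch-N n zero a f = ≗refl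
Poch-N n (suc k) a f = N-cong (n + suc k) (Poch-N n k a f) ∙ N-comm (n + suc k) a (Poch n k f)

Poch-divPoch : ∀ k f → Poch 0 k (divPoch k f) ≗ f
Poch-divPoch zero f = ≗refl
Poch-divPoch (suc k) f = N-cong (suc k) (Poch-G 0 k k (divPoch k f)) ∙ NG k _ ∙ Poch-divPoch k f

divPoch-Poch : ∀ k f → divPoch k (Poch 0 k f) ≗ f
divPoch-Poch zero f = ≗refl
divPoch-Poch (suc k) f = G-cong k (divPoch-N k (suc k) (Poch 0 k f)) ∙ GN k _ ∙ divPoch-Poch k f

Poch0-inj : ∀ k f g → Poch 0 k f ≗ Poch 0 k g → f ≗ g
Poch0-inj k f g e = ~ divPoch-Poch k f ∙ divPoch-cong k e ∙ divPoch-Poch k g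

Poch-peel : ∀ n k f → Poch n (suc k) f ≗ N (suc n) (Poch (suc n) k f)
Poch-peel n zero f = N-congk f (ℕP.+-comm n 1)
Poch-peel n (suc k) f = N-cong (n + suc (suc k)) (Poch-peel n k f)
  ∙ N-comm (n + suc (suc k)) (suc n) (Poch (suc n) k f)
  ∙ N-cong (suc n) (N-congk (Poch (suc n) k f) (ℕP.+-suc n (suc k)))

pascal : ∀ n k → gauss (suc n) (suc k) ≗ gauss (suc n) k ⊕ sh (suc k) (gauss n (suc k))
pascal n k = Poch0-inj (suc k) _ _ (Poch-divPoch (suc k) _ ∙ ~ rhs)
  where
  W = Poch (suc n) k δ
  rhs : Poch 0 (suc k) (gauss (suc n) k ⊕ sh (suc k) (gauss n (suc k))) ≗ Poch (suc n) (suc k) δ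
  rhs = Poch-⊕ 0 (suc k) _ _
      ∙ ⊕-cong (N-cong (suc k) (Poch-divPoch k W))
               (Poch-sh 0 (suc k) (suc k) _ ∙ sh-cong (suc k) (Poch-divPoch (suc k) _ ∙ Poch-peel n k δ))
      ∙ ~ N-+ (suc n) (suc k) W

Supp-gauss : ∀ n k → Supp (n * k) (gauss n k)
Supp-gauss zero k = Supp-cong (~ divPoch-Poch k δ) Supp-δ
Supp-gauss (suc n) zero = Supp-mono z≤n Supp-δ
Supp-gauss (suc n) (suc k) = Supp-cong (~ pascal n k)
  (Supp-⊕ (Supp-mono (ℕP.*-monoʳ-≤ (suc n) (ℕP.n≤1+n k)) (Supp-gauss (suc n) k))
          (Supp-sh (suc k) (Supp-gauss n (suc k))))

-- The series 1/((1−q^3)(1−q^5)), 1/((1−q^3)(1−q^4)(1−q^5)), 1/((1−q)(1−q^3)(1−q^5))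

byComputation : ∀ {P : ℕ → Set} (P? : Decidable P) v → {True (ℕP.allUpTo? P? v)} → ∀ z → z < v → P z
byComputation P? v {t} z lt = toWitness t lt

-- inv35 m = #{(a, b) : 3a + 5b = m}: a table of 15 values, then +1 every 15 steps.
inv35 : Series
inv35 0 = + 1
inv35 1 = + 0
inv35 2 = + 0
inv35 3 = + 1
inv35 4 = + 0
inv35 5 = + 1
inv35 6 = + 1
inv35 7 = + 0
inv35 8 = + 1
inv35 9 = + 1
inv35 10 = + 1
inv35 11 = + 1
inv35 12 = + 1
inv35 13 = + 1
inv35 14 = + 1
inv35 (suc (suc (suc (suc (suc (suc (suc (suc (suc (suc (suc (suc (suc (suc (suc z))))))))))))))) = 1ℤ +ᶻ inv35 z

inv345 : Series
inv345 0 = inv35 0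
inv345 1 = inv35 1
inv345 2 = inv35 2
inv345 3 = inv35 3
inv345 (suc (suc (suc (suc x)))) = inv35 (4 + x) +ᶻ inv345 x

inv135 : Series
inv135 zero = inv35 0
inv135 (suc y) = inv35 (suc y) +ᶻ inv135 y

N-inv345 : N 4 inv345 ≗ inv35
N-inv345 0 = refl
N-inv345 1 = refl
N-inv345 2 = refl
N-inv345 3 = refl
N-inv345 (suc (suc (suc (suc x)))) = lem (inv35 (4 + x)) (inv345 x)
  where
  lem : ∀ a b → (a +ᶻ b) -ᶻ b ≡ a
  lem = solve-∀

N-inv135 : N 1 inv135 ≗ inv35
N-inv135 zero = refl
N-inv135 (suc y) = lem (inv35 (suc y)) (inv135 y)
  where
  lem : ∀ a b → (a +ᶻ b) -ᶻ b ≡ a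
  lem = solve-∀

-- (1 − q^3)(1 − q^5)·inv35 = 1: checked on 23 values, and the +1 of inv35
-- cancels in the second difference.
N35-inv35 : N 3 (N 5 inv35) ≗ δ
N35-inv35 = periodic-induction (λ z → N 3 (N 5 inv35) z ≡ δ z) 14 8
  (byComputation (λ z → N 3 (N 5 inv35) z ≟ᶻ δ z) 23)
  (λ w h → trans (lem (inv35 (8 + w)) (inv35 (3 + w)) (inv35 (5 + w)) (inv35 w)) h)
  where
  lem : ∀ a b c d → ((1ℤ +ᶻ a) -ᶻ (1ℤ +ᶻ b)) -ᶻ ((1ℤ +ᶻ c) -ᶻ (1ℤ +ᶻ d)) ≡ (a -ᶻ b) -ᶻ (c -ᶻ d)
  lem = solve-∀

inv35≗ : inv35 ≗ G 5 (G 3 δ)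
inv35≗ = ~ (G-cong 4 (G-cong 2 (~ N35-inv35) ∙ GN 2 (N 5 inv35)) ∙ GN 4 inv35)

div345-δ : div345 δ ≗ inv345
div345-δ = GG-comm 2 3 (G 5 δ) ∙ G-cong 3 (GG-comm 2 4 δ) ∙ G-cong 3 (~ inv35≗) ∙ G-cong 3 (~ N-inv345) ∙ GN 3 inv345

qint4-inv345 : act (qint 4) inv345 ≗ inv135
qint4-inv345 = N-inj 0 _ _ (N1-qint 4 inv345 ∙ N-inv345 ∙ ~ N-inv135)

inv35≥0 : ∀ z → 0ℤ ≤ᶻ inv35 z
inv35≥0 = periodic-induction _ 14 0 (byComputation (λ z → 0ℤ ≤ᶻ? inv35 z) 15)
  (λ w h → ℤP.+-mono-≤ (+≤+ z≤n) h)

inv35-mono3 : ∀ z → inv35 z ≤ᶻ inv35 (3 + z)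
inv35-mono3 = periodic-induction _ 14 0 (byComputation (λ z → inv35 z ≤ᶻ? inv35 (3 + z)) 15)
  (λ w h → ℤP.+-monoʳ-≤ 1ℤ h)

inv345≥0 : ∀ x → 0ℤ ≤ᶻ inv345 x
inv345≥0 = periodic-induction _ 3 0 (byComputation (λ z → 0ℤ ≤ᶻ? inv345 z) 4)
  (λ w h → ℤP.+-mono-≤ (inv35≥0 (4 + w)) h)

inv345-mono3 : ∀ x → inv345 x ≤ᶻ inv345 (3 + x)
inv345-mono3 = periodic-induction _ 3 0 (byComputation (λ z → inv345 z ≤ᶻ? inv345 (3 + z)) 4)
  (λ w h → ℤP.+-mono-≤ (inv35-mono3 (4 + w)) h)

sumTo : ℕ → (ℕ → ℤ) → ℤ
sumTo zero f = 0ℤ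
sumTo (suc k) f = f k +ᶻ sumTo k f

sumTo-shift : ∀ k f g c → (∀ j → f j ≡ c +ᶻ g j) → sumTo k f ≡ (+ k) *ᶻ c +ᶻ sumTo k g
sumTo-shift zero f g c h = sym (cong (_+ᶻ 0ℤ) (ℤP.*-zeroˡ c))
sumTo-shift (suc k) f g c h = trans (cong₂ _+ᶻ_ (h k) (sumTo-shift k f g c h))
  (trans (lem c (g k) (+ k *ᶻ c) (sumTo k g)) (cong (λ t → t +ᶻ (g k +ᶻ sumTo k g)) (sym succ-times)))
  where
  lem : ∀ c a b d → (c +ᶻ a) +ᶻ (b +ᶻ d) ≡ (c +ᶻ b) +ᶻ (a +ᶻ d)
  lem = solve-∀
  succ-times : (+ suc k) *ᶻ c ≡ c +ᶻ (+ k) *ᶻ c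
  succ-times = trans (cong (_*ᶻ c) (ℤP.pos-+ 1 k))
    (trans (ℤP.*-distribʳ-+ c (+ 1) (+ k)) (cong (_+ᶻ (+ k *ᶻ c)) (ℤP.*-identityˡ c)))

inv345-unfold : ∀ k x → inv345 (k * 4 + x) ≡ inv345 x +ᶻ sumTo k (λ j → inv35 (4 + (j * 4 + x)))
inv345-unfold zero x = sym (ℤP.+-identityʳ _)
inv345-unfold (suc k) x = trans (cong (inv35 (4 + (k * 4 + x)) +ᶻ_) (inv345-unfold k x))
  (lem (inv35 (4 + (k * 4 + x))) (inv345 x) _)
  where
  lem : ∀ a b c → a +ᶻ (b +ᶻ c) ≡ b +ᶻ (a +ᶻ c)
  lem = solve-∀

inv135-unfold : ∀ k y → inv135 (k + y) ≡ inv135 y +ᶻ sumTo k (λ i → inv35 (suc (i + y)))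
inv135-unfold zero y = sym (ℤP.+-identityʳ _)
inv135-unfold (suc k) y = trans (cong (inv35 (suc (k + y)) +ᶻ_) (inv135-unfold k y))
  (lem (inv35 (suc (k + y))) (inv135 y) _)
  where
  lem : ∀ a b c → a +ᶻ (b +ᶻ c) ≡ b +ᶻ (a +ᶻ c)
  lem = solve-∀

-- F c e y = inv345 (c + 2y) − inv135 (e + y) compares the two series along
-- lines of slope 2; the claim of this section is that it is ≥ 0 for
-- c ∈ {3, 4, 5}, e = 0.
F : ℕ → ℕ → ℕ → ℤ
F c e y = inv345 (c + (y + y)) -ᶻ inv135 (e + y)

PeriodicIncrement : (ℕ → ℤ) → Set
PeriodicIncrement H = ∀ y → H (45 + y) -ᶻ H (15 + y) ≡ H (30 + y) -ᶻ H y

PeriodicIncrement-nonneg : ∀ H → PeriodicIncrement H →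
  (∀ y → y < 30 → 0ℤ ≤ᶻ H y) → (∀ y → y < 15 → 0ℤ ≤ᶻ H (30 + y) -ᶻ H y) → ∀ y → 0ℤ ≤ᶻ H y
PeriodicIncrement-nonneg H per c1 c2 = periodic-induction _ 29 0 c1
  (λ w h → ℤP.≤-trans (ℤP.+-mono-≤ (increment w) h) (ℤP.≤-reflexive (lem (H (30 + w)) (H w))))
  where
  increment : ∀ y → 0ℤ ≤ᶻ H (30 + y) -ᶻ H y
  increment = periodic-induction _ 14 0 c2 (λ w h → subst (0ℤ ≤ᶻ_) (sym (per w)) h)
  lem : ∀ a b → (a -ᶻ b) +ᶻ b ≡ a
  lem = solve-∀

PeriodicIncrement-+ : ∀ H H' → PeriodicIncrement H → PeriodicIncrement H' → PeriodicIncrement (λ y → H y +ᶻ H' y)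
PeriodicIncrement-+ H H' p p' y = trans (lem (H (45 + y)) (H' (45 + y)) (H (15 + y)) (H' (15 + y)))
  (trans (cong₂ _+ᶻ_ (p y) (p' y)) (sym (lem (H (30 + y)) (H' (30 + y)) (H y) (H' y))))
  where
  lem : ∀ a b c d → (a +ᶻ b) -ᶻ (c +ᶻ d) ≡ (a -ᶻ c) +ᶻ (b -ᶻ d)
  lem = solve-∀

-- the 15 terms gained by inv345 over 60 steps, and the 30 gained by inv135 over 30 steps
gain345 : ℕ → ℤ
gain345 x = sumTo 15 (λ j → inv35 (4 + (j * 4 + x)))

gain135 : ℕ → ℤ
gain135 w = sumTo 30 (λ i → inv35 (suc (i + w)))

F-increment : ∀ c e y → F c e (30 + y) -ᶻ F c e y ≡ gain345 (c + (y + y)) -ᶻ gain135 (e + y)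
F-increment c e y = begin
    (inv345 (c + ((30 + y) + (30 + y))) -ᶻ inv135 (e + (30 + y))) -ᶻ F c e y
  ≡⟨ cong₂ (λ a b → (a -ᶻ b) -ᶻ F c e y)
       (trans (cong inv345 (idx₁ c y)) (inv345-unfold 15 (c + (y + y))))
       (trans (cong inv135 (idx₂ e y)) (inv135-unfold 30 (e + y))) ⟩
    ((inv345 x +ᶻ gain345 x) -ᶻ (inv135 w +ᶻ gain135 w)) -ᶻ (inv345 x -ᶻ inv135 w)
  ≡⟨ lem (inv345 x) (gain345 x) (inv135 w) (gain135 w) ⟩
    gain345 x -ᶻ gain135 w ∎
  where
  open ≡-Reasoning
  x = c + (y + y)
  w = e + y
  idx₁ : ∀ c y → c + ((30 + y) + (30 + y)) ≡ 15 * 4 + (c + (y + y))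
  idx₁ = ℕSolver.solve-∀
  idx₂ : ∀ e y → e + (30 + y) ≡ 30 + (e + y)
  idx₂ = ℕSolver.solve-∀
  lem : ∀ a s b t → ((a +ᶻ s) -ᶻ (b +ᶻ t)) -ᶻ (a -ᶻ b) ≡ s -ᶻ t
  lem = solve-∀

-- Every term of inv35 grows by 2 over 30 steps, by 1 over 15 steps.
gain345-period : ∀ x → gain345 (30 + x) ≡ + 30 +ᶻ gain345 x
gain345-period x = sumTo-shift 15 _ (λ j → inv35 (4 + (j * 4 + x))) (+ 2) (λ j → trans (cong inv35 (idx j x)) (lem (inv35 (4 + (j * 4 + x)))))
  where
  idx : ∀ j x → 4 + (j * 4 + (30 + x)) ≡ 30 + (4 + (j * 4 + x))
  idx = ℕSolver.solve-∀
  lem : ∀ a → 1ℤ +ᶻ (1ℤ +ᶻ a) ≡ + 2 +ᶻ a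
  lem = solve-∀

gain135-period : ∀ w → gain135 (15 + w) ≡ + 30 +ᶻ gain135 w
gain135-period w = sumTo-shift 30 _ (λ i → inv35 (suc (i + w))) 1ℤ (λ i → cong inv35 (idx i w))
  where
  idx : ∀ i w → suc (i + (15 + w)) ≡ 15 + suc (i + w)
  idx = ℕSolver.solve-∀

F-periodic : ∀ c e → PeriodicIncrement (F c e)
F-periodic c e y = begin
    F c e (30 + (15 + y)) -ᶻ F c e (15 + y)
  ≡⟨ F-increment c e (15 + y) ⟩
    gain345 (c + ((15 + y) + (15 + y))) -ᶻ gain135 (e + (15 + y))
  ≡⟨ cong₂ _-ᶻ_ (trans (cong gain345 (idx₁ c y)) (gain345-period (c + (y + y))))
                (trans (cong gain135 (idx₂ e y)) (gain135-period (e + y))) ⟩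
    (+ 30 +ᶻ gain345 (c + (y + y))) -ᶻ (+ 30 +ᶻ gain135 (e + y))
  ≡⟨ lem (gain345 (c + (y + y))) (gain135 (e + y)) ⟩
    gain345 (c + (y + y)) -ᶻ gain135 (e + y)
  ≡⟨ sym (F-increment c e y) ⟩
    F c e (30 + y) -ᶻ F c e y ∎
  where
  open ≡-Reasoning
  idx₁ : ∀ c y → c + ((15 + y) + (15 + y)) ≡ 30 + (c + (y + y))
  idx₁ = ℕSolver.solve-∀
  idx₂ : ∀ e y → e + (15 + y) ≡ 15 + (e + y)
  idx₂ = ℕSolver.solve-∀
  lem : ∀ s t → (+ 30 +ᶻ s) -ᶻ (+ 30 +ᶻ t) ≡ s -ᶻ t
  lem = solve-∀

nonneg-by-computation : ∀ H → PeriodicIncrement H →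
  {True (ℕP.allUpTo? (λ y → 0ℤ ≤ᶻ? H y) 30)} → {True (ℕP.allUpTo? (λ y → 0ℤ ≤ᶻ? H (30 + y) -ᶻ H y) 15)} →
  ∀ y → 0ℤ ≤ᶻ H y
nonneg-by-computation H per {t₁} {t₂} = PeriodicIncrement-nonneg H per (λ y lt → toWitness t₁ lt) (λ y lt → toWitness t₂ lt)

-- inv135 y ≤ inv345 (t + 3 + 2y) for all t: the cases t = 0, 1, 2 are F ≥ 0,
-- larger t follow since inv345 increases in steps of 3.
inv135≤inv345 : ∀ y t → inv135 y ≤ᶻ inv345 (t + (3 + (y + y)))
inv135≤inv345 y = periodic-induction _ 2 0 base (λ w h → ℤP.≤-trans h (inv345-mono3 (w + (3 + (y + y)))))
  where
  from-F : ∀ c → 0ℤ ≤ᶻ F c 0 y → inv135 y ≤ᶻ inv345 (c + (y + y))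
  from-F c h = ℤP.0≤i-j⇒j≤i h
  base : ∀ t → t < 3 → inv135 y ≤ᶻ inv345 (t + (3 + (y + y)))
  base 0 _ = from-F 3 (nonneg-by-computation (F 3 0) (F-periodic 3 0) y)
  base 1 _ = from-F 4 (nonneg-by-computation (F 4 0) (F-periodic 4 0) y)
  base 2 _ = from-F 5 (nonneg-by-computation (F 5 0) (F-periodic 5 0) y)
  base (suc (suc (suc t))) (s≤s (s≤s (s≤s ())))

-- The combination needed at the top coefficient when d = 5.
F64≥0 : ∀ y → 0ℤ ≤ᶻ F 6 2 y +ᶻ F 4 0 y
F64≥0 = nonneg-by-computation _ (PeriodicIncrement-+ (F 6 2) (F 4 0) (F-periodic 6 2) (F-periodic 4 0))

-- Coefficient lists, parity and unimodality

mkList : ℕ → Series → List ℤ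
mkList zero f = []
mkList (suc L) f = f 0 ∷ mkList L (λ i → f (suc i))

coeff-mk-lt : ∀ L f m → m < L → coeff (mkList L f) m ≡ f m
coeff-mk-lt (suc L) f zero _ = refl
coeff-mk-lt (suc L) f (suc m) (s≤s m<L) = coeff-mk-lt L (λ i → f (suc i)) m m<L

coeff-mk-ge : ∀ L f m → L ≤ m → coeff (mkList L f) m ≡ 0ℤ
coeff-mk-ge zero f m _ = refl
coeff-mk-ge (suc L) f (suc m) (s≤s L≤m) = coeff-mk-ge L (λ i → f (suc i)) m L≤m

coeff-mk : ∀ D f → Supp D f → coeff (mkList (suc D) f) ≗ f
coeff-mk D f sp m with ℕP.<-≤-connex m (suc D)
... | inj₁ lt = coeff-mk-lt (suc D) f m lt
... | inj₂ ge = trans (coeff-mk-ge (suc D) f m ge) (sym (sp m ge))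

length-mk : ∀ L f → length (mkList L f) ≡ L
length-mk zero f = refl
length-mk (suc L) f = cong suc (length-mk L (λ i → f (suc i)))

norm-mk : ∀ D f → ¬ (f D ≡ 0ℤ) → Normalized (mkList (suc D) f)
norm-mk zero f ne = single ne
norm-mk (suc D) f ne = cons (norm-mk D (λ i → f (suc i)) ne)

dbl : ℕ → ℕ
dbl zero = zero
dbl (suc i) = suc (suc (dbl i))

dbl≡ : ∀ h → dbl h ≡ h + h
dbl≡ zero = refl
dbl≡ (suc h) = cong suc (trans (cong suc (dbl≡ h)) (sym (ℕP.+-suc h h)))

dbl-dbl≡ : ∀ h → dbl (dbl h) ≡ (h + h) + (h + h)
dbl-dbl≡ h = trans (dbl≡ (dbl h)) (cong₂ _+_ (dbl≡ h) (dbl≡ h))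

dbl-mono : ∀ {a b} → a ≤ b → dbl a ≤ dbl b
dbl-mono z≤n = z≤n
dbl-mono (s≤s p) = s≤s (s≤s (dbl-mono p))

coeff-evens : ∀ l i → coeff (evens l) i ≡ coeff l (dbl i)
coeff-odds : ∀ l i → coeff (odds l) i ≡ coeff l (suc (dbl i))
coeff-evens [] i = refl
coeff-evens (a ∷ l) zero = refl
coeff-evens (a ∷ l) (suc i) = coeff-odds l i
coeff-odds [] i = refl
coeff-odds (a ∷ l) i = coeff-evens l i

len-evens : ∀ l i → i < length (evens l) → dbl i < length l
len-odds : ∀ l i → i < length (odds l) → suc (dbl i) < length l
len-evens [] i ()
len-evens (a ∷ l) zero _ = s≤s z≤n
len-evens (a ∷ l) (suc i) (s≤s p) = s≤s (len-odds l i p)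
len-odds [] i ()
len-odds (a ∷ l) i p = s≤s (len-evens l i p)

parity-unimodal : ∀ K c →
  (∀ t → 2 + t ≤ suc (dbl K) → c t ≤ᶻ c (2 + t)) →
  (∀ t → dbl K ≤ t → 2 + t ≤ dbl (dbl K) → c (2 + t) ≤ᶻ c t) →
  UnimodalParity (mkList (suc (dbl (dbl K))) c)
parity-unimodal K c up down = (K , ev-up , ev-down) , (K , od-up , od-down)
  where
  L = suc (dbl (dbl K))
  P = mkList L c
  cP : ∀ m → m < L → coeff P m ≡ c m
  cP m = coeff-mk-lt L c m
  lenP = length-mk L c
  ev-bound : ∀ i → suc i < length (evens P) → 2 + dbl i < L
  ev-bound i p = subst (suc (suc (dbl i)) <_) lenP (len-evens P (suc i) p)
  od-bound : ∀ i → suc i < length (odds P) → 3 + dbl i < L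
  od-bound i p = subst (suc (suc (suc (dbl i))) <_) lenP (len-odds P (suc i) p)
  ev-pair : ∀ i → suc i < length (evens P) → (coeff (evens P) i ≡ c (dbl i)) × (coeff (evens P) (suc i) ≡ c (2 + dbl i))
  ev-pair i p = trans (coeff-evens P i) (cP (dbl i) (ℕP.<-trans (ℕP.n<1+n _) (ℕP.<-trans (ℕP.n<1+n _) (ev-bound i p))))
              , trans (coeff-evens P (suc i)) (cP (2 + dbl i) (ev-bound i p))
  od-pair : ∀ i → suc i < length (odds P) → (coeff (odds P) i ≡ c (suc (dbl i))) × (coeff (odds P) (suc i) ≡ c (3 + dbl i))
  od-pair i p = trans (coeff-odds P i) (cP (suc (dbl i)) (ℕP.<-trans (ℕP.n<1+n _) (ℕP.<-trans (ℕP.n<1+n _) (od-bound i p))))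
              , trans (coeff-odds P (suc i)) (cP (3 + dbl i) (od-bound i p))
  ev-up : ∀ i → suc i ≤ K → suc i < length (evens P) → coeff (evens P) i ≤ᶻ coeff (evens P) (suc i)
  ev-up i si≤K p with ev-pair i p
  ... | e₁ , e₂ = subst₂ _≤ᶻ_ (sym e₁) (sym e₂) (up (dbl i) (ℕP.m≤n⇒m≤1+n (dbl-mono si≤K)))
  ev-down : ∀ i → K ≤ i → suc i < length (evens P) → coeff (evens P) (suc i) ≤ᶻ coeff (evens P) i
  ev-down i K≤i p with ev-pair i p
  ... | e₁ , e₂ = subst₂ _≤ᶻ_ (sym e₂) (sym e₁) (down (dbl i) (dbl-mono K≤i) (ℕP.≤-pred (ev-bound i p)))
  od-up : ∀ i → suc i ≤ K → suc i < length (odds P) → coeff (odds P) i ≤ᶻ coeff (odds P) (suc i)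
  od-up i si≤K p with od-pair i p
  ... | e₁ , e₂ = subst₂ _≤ᶻ_ (sym e₁) (sym e₂) (up (suc (dbl i)) (s≤s (dbl-mono si≤K)))
  od-down : ∀ i → K ≤ i → suc i < length (odds P) → coeff (odds P) (suc i) ≤ᶻ coeff (odds P) i
  od-down i K≤i p with od-pair i p
  ... | e₁ , e₂ = subst₂ _≤ᶻ_ (sym e₂) (sym e₁) (down (suc (dbl i)) (ℕP.m≤n⇒m≤1+n (dbl-mono K≤i)) (ℕP.≤-pred (od-bound i p)))

palindrome-unimodal : ∀ K c → (∀ a b → a + b ≡ dbl (dbl K) → c a ≡ c b) →
  (∀ t → 2 + t ≤ dbl K → c t ≤ᶻ c (2 + t)) → UnimodalParity (mkList (suc (dbl (dbl K))) c)
palindrome-unimodal K c pal up' = parity-unimodal K c up down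
  where
  H = dbl K
  up : ∀ t → 2 + t ≤ suc H → c t ≤ᶻ c (2 + t)
  up t le with ℕP.m≤n⇒m<n∨m≡n le
  ... | inj₁ (s≤s lt) = up' t lt
  ... | inj₂ e = ℤP.≤-reflexive (pal t (2 + t) middle)
    where
    middle : t + (2 + t) ≡ dbl H
    middle = trans (ℕP.+-suc t (suc t)) (trans (cong (λ z → z + z) (ℕP.suc-injective e)) (sym (dbl≡ H)))
  down : ∀ t → H ≤ t → 2 + t ≤ dbl H → c (2 + t) ≤ᶻ c t
  down t H≤t le with ℕP.m≤n⇒∃[o]m+o≡n le
  ... | (t' , e) = subst₂ _≤ᶻ_ (sym (pal (2 + t) t' e)) (pal (2 + t') t e') (up' t' le')
    where
    e' : (2 + t') + t ≡ dbl H
    e' = trans (cong (λ z → 2 + z) (ℕP.+-comm t' t)) (trans (sym (ℕP.+-assoc 2 t t')) e)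
    le' : 2 + t' ≤ H
    le' = ℕP.+-cancelʳ-≤ H (2 + t') H (ℕP.≤-trans (ℕP.+-monoʳ-≤ (2 + t') H≤t) (ℕP.≤-reflexive (trans e' (dbl≡ H))))

-- The series c = [d]·(q^{n+1};q)_4 / ((1 − q^2)(1 − q^3)(1 − q^4)(1 − q^5))

qrise : ℕ → ℕ → Poly
qrise n zero = qint 1
qrise n (suc k) = qint (n + suc k) *ₚ qrise n k

qfact-split : ∀ k n f → act (qfact (k + n)) f ≗ act (qrise n k) (act (qfact n) f)
qfact-split zero n f = ~ act-qint1 (act (qfact n) f)
qfact-split (suc k) n f = act-* (qint (suc (k + n))) (qfact (k + n)) f
  ∙ act-cong (qint (suc (k + n))) (qfact-split k n f)
  ∙ (λ m → cong (λ i → act (qint i) (act (qrise n k) (act (qfact n) f)) m) (idx k n))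
  ∙ ~ act-* (qint (n + suc k)) (qrise n k) (act (qfact n) f)
  where
  idx : ∀ k n → suc (k + n) ≡ n + suc k
  idx = ℕSolver.solve-∀

powN1 : ℕ → Series → Series
powN1 zero f = f
powN1 (suc k) f = N 1 (powN1 k f)

powN1-cong : ∀ k {f g} → f ≗ g → powN1 k f ≗ powN1 k g
powN1-cong zero e = e
powN1-cong (suc k) e = N-cong 1 (powN1-cong k e)

powN1-act : ∀ k p f → powN1 k (act p f) ≗ act p (powN1 k f)
powN1-act zero p f = ≗refl
powN1-act (suc k) p f = N-cong 1 (powN1-act k p f) ∙ ~ act-N p 1 (powN1 k f)

powN1-inj : ∀ k f g → powN1 k f ≗ powN1 k g → f ≗ g
powN1-inj zero f g e = e
powN1-inj (suc k) f g e = powN1-inj k f g (N-inj 0 _ _ e)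

powN1-qrise : ∀ n k f → powN1 k (act (qrise n k) f) ≗ Poch n k f
powN1-qrise n zero f = act-qint1 f
powN1-qrise n (suc k) f = N-cong 1 (powN1-cong k (act-* (qint (n + suc k)) (qrise n k) f) ∙ powN1-act k (qint (n + suc k)) (act (qrise n k) f) ∙ act-cong (qint (n + suc k)) (powN1-act k (qrise n k) f))
  ∙ N1-qint (n + suc k) (act (qrise n k) (powN1 k f))
  ∙ N-cong (n + suc k) (~ powN1-act k (qrise n k) f ∙ powN1-qrise n k f)

[_]δ : ℕ → Series
[ d ]δ = act (qint d) δ

numer : ℕ → ℕ → Series
numer d n = Poch n 4 [ d ]δ

cSer : ℕ → ℕ → Series
cSer d n = divDen (numer d n)

Den-cSer : ∀ d n → Den (cSer d n) ≗ numer d n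
Den-cSer d n = Den-divDen (numer d n)

-- [5]!·c = [n+1][n+2][n+3][n+4]·[d], compared after multiplying by (1 − q)^5.
qfact5-cSer : ∀ d n → act (qfact 5) (cSer d n) ≗ act (qrise n 4) [ d ]δ
qfact5-cSer d n = powN1-inj 5 _ _ (powN1-qrise 0 5 c ∙ N-comm-Den ∙ N-cong 1 (Den-cSer d n)
                                    ∙ ~ N-cong 1 (powN1-qrise n 4 [ d ]δ))
  where
  c = cSer d n
  N-comm-Den : Den (N 1 c) ≗ N 1 (Den c)
  N-comm-Den = N-cong 5 (N-cong 4 (N-cong 3 (N-comm 2 1 c) ∙ N-comm 3 1 (N 2 c)) ∙ N-comm 4 1 (N 3 (N 2 c)))
             ∙ N-comm 5 1 (N 4 (N 3 (N 2 c)))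

cSer-identity : ∀ d n P → coeff P ≗ cSer d n →
  (P *ₚ (qint (5 + n) *ₚ (qfact 5 *ₚ qfact n)) ≈ₚ (qint d *ₚ qfact (5 + n)))
cSer-identity d n P cP = coeff-act LHS ∙ lhs ∙ ~ rhs ∙ ~ coeff-act RHS
  where
  I = qint (5 + n)
  F5 = qfact 5
  Fn = qfact n
  LHS = P *ₚ (I *ₚ (F5 *ₚ Fn))
  RHS = qint d *ₚ qfact (5 + n)
  c = cSer d n
  common : Series
  common = act I (act (qrise n 4) (act (qint d) (act Fn δ)))
  lhs : act LHS δ ≗ common
  lhs = act-* P (I *ₚ (F5 *ₚ Fn)) δ
      ∙ act-cong P (act-* I (F5 *ₚ Fn) δ ∙ act-cong I (act-* F5 Fn δ))
      ∙ act-comm P I (act F5 (act Fn δ))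
      ∙ act-cong I (act-comm P F5 (act Fn δ) ∙ act-cong F5 (act-comm P Fn δ ∙ act-cong Fn (~ coeff-act P ∙ cP)))
      ∙ act-cong I (act-comm F5 Fn c ∙ act-cong Fn (qfact5-cSer d n) ∙ act-comm Fn (qrise n 4) [ d ]δ
                    ∙ act-cong (qrise n 4) (act-comm Fn (qint d) δ))
  rhs : act RHS δ ≗ common
  rhs = act-* (qint d) (qfact (5 + n)) δ
      ∙ act-cong (qint d) (act-* I (qfact (4 + n)) δ ∙ act-cong I (qfact-split 4 n δ))
      ∙ act-comm (qint d) I _
      ∙ act-cong I (act-comm (qint d) (qrise n 4) (act Fn δ))

coeff-qint-lt : ∀ k m → m < k → coeff (qint k) m ≡ 1ℤ
coeff-qint-lt (suc k) zero _ = refl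
coeff-qint-lt (suc k) (suc m) (s≤s lt) = coeff-qint-lt k m lt

coeff-qint-ge : ∀ k m → k ≤ m → coeff (qint k) m ≡ 0ℤ
coeff-qint-ge zero m _ = refl
coeff-qint-ge (suc k) (suc m) (s≤s le) = coeff-qint-ge k m le

Supp-qint : ∀ e → Supp e [ suc e ]δ
Supp-qint e m lt = trans (sym (coeff-act (qint (suc e)) m)) (coeff-qint-ge (suc e) m lt)

rev-qint : ∀ e → rev e [ suc e ]δ ≗ [ suc e ]δ
rev-qint e = rev-ext e [ suc e ]δ [ suc e ]δ pair (Supp-qint e)
  where
  one : ∀ m → m ≤ e → [ suc e ]δ m ≡ 1ℤ
  one m le = trans (sym (coeff-act (qint (suc e)) m)) (coeff-qint-lt (suc e) m (s≤s le))
  pair : ∀ m u → m + u ≡ e → [ suc e ]δ m ≡ [ suc e ]δ u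
  pair m u eq = trans (one m (subst (m ≤_) eq (ℕP.m≤m+n m u))) (sym (one u (subst (u ≤_) eq (ℕP.m≤n+m u m))))

numerDeg : ℕ → ℕ → ℕ
numerDeg e n = (n + 4) + ((n + 3) + ((n + 2) + ((n + 1) + e)))

Supp-numer : ∀ e n → Supp (numerDeg e n) (numer (suc e) n)
Supp-numer e n = Supp-N (n + 4) (Supp-N (n + 3) (Supp-N (n + 2) (Supp-N (n + 1) (Supp-qint e))))

rev-numer : ∀ e n → rev (numerDeg e n) (numer (suc e) n) ≗ numer (suc e) n
rev-numer e n = rev-NN (n + 4) (n + 3) ((n + 2) + ((n + 1) + e)) _ (Supp-N (n + 2) (Supp-N (n + 1) (Supp-qint e)))
  ∙ N-cong (n + 4) (N-cong (n + 3) (rev-NN (n + 2) (n + 1) e _ (Supp-qint e) ∙ N-cong (n + 2) (N-cong (n + 1) (rev-qint e))))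

cSer-palindromic : ∀ e n D → numerDeg e n ≡ 14 + D → Supp D (cSer (suc e) n) →
  ∀ a b → a + b ≡ D → cSer (suc e) n a ≡ cSer (suc e) n b
cSer-palindromic e n D deg sp = palindromic-quotient D (cSer (suc e) n) (numer (suc e) n) sp (Den-cSer (suc e) n)
  (subst (λ B → rev B (numer (suc e) n) ≗ numer (suc e) n) deg (rev-numer e n))

Supp-Den-cSer : ∀ e n D → numerDeg e n ≡ 14 + D → Supp (14 + D) (Den (cSer (suc e) n))
Supp-Den-cSer e n D deg = Supp-reindex deg (Supp-cong (~ Den-cSer (suc e) n) (Supp-numer e n))

-- The 2-step differences of c below the middle

qint-last : ∀ k f → act (qint (suc k)) f ≗ act (qint k) f ⊕ sh k f
qint-last zero f m = trans (act-qint1 f m) (sym (ℤP.+-identityˡ (f m)))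
qint-last (suc k) f m = begin
    1ℤ *ᶻ f m +ᶻ mulq (act (qint (suc k)) f) m
  ≡⟨ cong (1ℤ *ᶻ f m +ᶻ_) ((mulq-cong (qint-last k f) ∙ mulq-⊕ (act (qint k) f) (sh k f)) m) ⟩
    1ℤ *ᶻ f m +ᶻ (mulq (act (qint k) f) m +ᶻ sh (suc k) f m)
  ≡⟨ sym (ℤP.+-assoc (1ℤ *ᶻ f m) _ _) ⟩
    (1ℤ *ᶻ f m +ᶻ mulq (act (qint k) f) m) +ᶻ sh (suc k) f m ∎
  where open ≡-Reasoning

Agree-≗ : ∀ {T f g h} → Agree T f g → g ≗ h → Agree T f h
Agree-≗ ag e m le = trans (ag m le) (e m)

N-agree : ∀ a T g Z U → Agree T g (Z ⊖ U) → (∀ x → a + x ≤ T → U x ≡ 0ℤ) → Agree T (N a g) (Z ⊖ (U ⊕ sh a Z))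
N-agree a T g Z U ag uz m le with split a m
... | inj₁ m<a = trans (cong₂ _-ᶻ_ (ag m le) (sh-lo a g m m<a))
    (trans (lem (Z m) (U m)) (cong (λ t → Z m -ᶻ (U m +ᶻ t)) (sym (sh-lo a Z m m<a))))
  where
  lem : ∀ z u → (z -ᶻ u) -ᶻ 0ℤ ≡ z -ᶻ (u +ᶻ 0ℤ)
  lem = solve-∀
... | inj₂ (x , refl) = trans (cong₂ _-ᶻ_ (ag (a + x) le)
      (trans (sh-hi a g x) (trans (ag x (ℕP.≤-trans (ℕP.m≤n+m x a) le)) (cong (Z x -ᶻ_) (uz x le)))))
    (trans (lem (Z (a + x)) (U (a + x)) (Z x)) (cong (λ t → Z (a + x) -ᶻ (U (a + x) +ᶻ t)) (sym (sh-hi a Z x))))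
  where
  lem : ∀ z u w → (z -ᶻ u) -ᶻ (w -ᶻ 0ℤ) ≡ z -ᶻ (u +ᶻ w)
  lem = solve-∀

-- Up to degree 2n + 2, (q^{n+1};q)_k ≡ 1 − q^{n+1}[k]: every product of two
-- factors q^{n+i} has degree ≥ 2n + 3.
Poch-agree : ∀ n k Z → Agree ((2 + n) + n) (Poch n k Z) (Z ⊖ sh (suc n) (act (qint k) Z))
Poch-agree n zero Z m _ = sym (trans (cong (Z m -ᶻ_) (sh-zeroS (suc n) m)) (ℤP.+-identityʳ (Z m)))
Poch-agree n (suc k) Z = Agree-≗ (N-agree (n + suc k) _ _ Z _ (Poch-agree n k Z) (low k))
  (⊖-cong (≗refl {Z}) (⊕-cong (≗refl {sh (suc n) (act (qint k) Z)}) (sh-cong′ ∙ sh-+ (suc n) k Z)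
    ∙ ~ sh-⊕ (suc n) (act (qint k) Z) (sh k Z) ∙ sh-cong (suc n) (~ qint-last k Z)))
  where
  sh-cong′ : sh (n + suc k) Z ≗ sh (suc n + k) Z
  sh-cong′ m = cong (λ i → sh i Z m) (ℕP.+-suc n k)
  low : ∀ k x → (n + suc k) + x ≤ (2 + n) + n → sh (suc n) (act (qint k) Z) x ≡ 0ℤ
  low zero x _ = sh-zeroS (suc n) x
  low (suc k) x le = sh-lo (suc n) _ x (s≤s (ℕP.+-cancelˡ-≤ (2 + n) x n (ℕP.≤-trans (ℕP.+-monoˡ-≤ x two+n≤) le)))
    where
    two+n≤ : 2 + n ≤ n + suc (suc k)
    two+n≤ = subst (_≤ n + suc (suc k)) (ℕP.+-comm n 2) (ℕP.+-monoʳ-≤ n (s≤s (s≤s z≤n)))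

-- phi n = A − q^{n+1} B with A = 1/((1−q^3)(1−q^4)(1−q^5)), B = [4]A
phi : ℕ → Series
phi n = inv345 ⊖ sh (suc n) inv135

N2-cSer-agree : ∀ d n → Agree ((2 + n) + n) (N 2 (cSer d n)) (act (qint d) (phi n))
N2-cSer-agree d n = Agree-≗ (λ m le → trans (NG 1 (div345 (numer d n)) m)
    (G-causal 2 T _ _ (G-causal 3 T _ _ (G-causal 4 T _ _ (Poch-agree n 4 Z))) m le))
  quotient
  where
  T = (2 + n) + n
  Z = [ d ]δ
  div345-act : ∀ p f → div345 (act p f) ≗ act p (div345 f)
  div345-act p f = G-cong 2 (G-cong 3 (~ act-G p 4 f) ∙ ~ act-G p 3 _) ∙ ~ act-G p 2 _
  div345-Z : div345 Z ≗ act (qint d) inv345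
  div345-Z = div345-act (qint d) δ ∙ act-cong (qint d) div345-δ
  quotient : div345 (Z ⊖ sh (suc n) (act (qint 4) Z)) ≗ act (qint d) (phi n)
  quotient = G-cong 2 (G-cong 3 (G-⊖ 4 _ _) ∙ G-⊖ 3 _ _) ∙ G-⊖ 2 _ _
    ∙ ⊖-cong div345-Z
        (G-cong 2 (G-cong 3 (G-sh 4 (suc n) _) ∙ G-sh 3 (suc n) _) ∙ G-sh 2 (suc n) _
         ∙ sh-cong (suc n) (div345-act (qint 4) Z ∙ act-cong (qint 4) div345-Z
                            ∙ act-comm (qint 4) (qint d) inv345 ∙ act-cong (qint d) qint4-inv345))
    ∙ ⊖-cong (≗refl {act (qint d) inv345}) (~ act-sh (qint d) (suc n) inv135)
    ∙ ~ act-⊖ (qint d) inv345 (sh (suc n) inv135)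

phi-nonneg : ∀ n x → suc x ≤ n + n → 0ℤ ≤ᶻ phi n x
phi-nonneg n x le with split (1 + n) x
... | inj₁ lt = subst (0ℤ ≤ᶻ_) (sym (trans (cong (inv345 x -ᶻ_) (sh-lo (1 + n) inv135 x lt)) (ℤP.+-identityʳ (inv345 x))))
                  (inv345≥0 x)
... | inj₂ (y , refl) with ℕP.m≤n⇒∃[o]m+o≡n (ℕP.+-cancelˡ-≤ n (2 + y) n (subst (_≤ n + n) (idx n y) le))
  where
  idx : ∀ n y → suc ((1 + n) + y) ≡ n + (2 + y)
  idx = ℕSolver.solve-∀
... | (t , refl) = subst (0ℤ ≤ᶻ_) (sym (cong (inv345 ((1 + n) + y) -ᶻ_) (sh-hi (1 + n) inv135 y)))
      (ℤP.i≤j⇒0≤j-i (subst (λ z → inv135 y ≤ᶻ inv345 z) (idx y t) (inv135≤inv345 y t)))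
  where
  idx : ∀ y t → t + (3 + (y + y)) ≡ (1 + ((2 + y) + t)) + y
  idx = ℕSolver.solve-∀

step-from-N2 : ∀ c t → 0ℤ ≤ᶻ N 2 c (2 + t) → c t ≤ᶻ c (2 + t)
step-from-N2 c t = ℤP.0≤i-j⇒j≤i

cSer1-increasing : ∀ n' t → 2 + t ≤ dbl n' → cSer 1 (suc n') t ≤ᶻ cSer 1 (suc n') (2 + t)
cSer1-increasing n' t le = step-from-N2 (cSer 1 (suc n')) t (subst (0ℤ ≤ᶻ_) (sym (trans (N2-cSer-agree 1 n (2 + t) le₁) (act-qint1 (phi n) (2 + t))))
                                                 (phi-nonneg n (2 + t) le₂))
  where
  n = suc n'
  le₀ : 2 + t ≤ n' + n'
  le₀ = subst (2 + t ≤_) (dbl≡ n') le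
  le₁ : 2 + t ≤ (2 + n) + n
  le₁ = ℕP.≤-trans le₀ (ℕP.+-mono-≤ (ℕP.m≤n+m n' 3) (ℕP.n≤1+n n'))
  le₂ : suc (2 + t) ≤ n + n
  le₂ = s≤s (ℕP.≤-trans le₀ (ℕP.+-monoʳ-≤ n' (ℕP.n≤1+n n')))

-- d = 5, n = y + 3: the 2-steps of c increase below the middle 2n.  At the
-- middle itself one summand of [5]·phi is negative and is paired with another.
cSer5-increasing : ∀ y t → 2 + t ≤ dbl (3 + y) → cSer 5 (3 + y) t ≤ᶻ cSer 5 (3 + y) (2 + t)
cSer5-increasing y t le = step-from-N2 (cSer 5 (3 + y)) t (subst (0ℤ ≤ᶻ_) (sym (N2-cSer-agree 5 n (2 + t) le′)) main)
  where
  n = 3 + y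
  f = phi n
  le′ : 2 + t ≤ (2 + n) + n
  le′ = ℕP.≤-trans (subst (2 + t ≤_) (dbl≡ n) le) (ℕP.+-monoˡ-≤ n (ℕP.m≤n+m n 2))
  f≥0 : ∀ x → suc x ≤ dbl n → 0ℤ ≤ᶻ f x
  f≥0 x l = phi-nonneg n x (subst (suc x ≤_) (dbl≡ n) l)
  dy = dbl y
  regroup : ∀ a b c d e → 1ℤ *ᶻ a +ᶻ (1ℤ *ᶻ b +ᶻ (1ℤ *ᶻ c +ᶻ (1ℤ *ᶻ d +ᶻ (1ℤ *ᶻ e +ᶻ 0ℤ)))) ≡ (a +ᶻ c) +ᶻ (b +ᶻ (d +ᶻ e))
  regroup = solve-∀
  at : ∀ c e → c + (y + y) ≡ (4 + y) + (e + y) → f (c + dy) ≡ F c e y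
  at c e idx = cong₂ _-ᶻ_ (cong (λ z → inv345 (c + z)) (dbl≡ y))
    (trans (cong (λ z → sh (4 + y) inv135 (c + z)) (dbl≡ y)) (trans (cong (sh (4 + y) inv135) idx) (sh-hi (4 + y) inv135 (e + y))))
  paired : f (6 + dy) +ᶻ f (4 + dy) ≡ F 6 2 y +ᶻ F 4 0 y
  paired = cong₂ _+ᶻ_ (at 6 2 (idx₆ y)) (at 4 0 (idx₄ y))
    where
    idx₆ : ∀ y → 6 + (y + y) ≡ (4 + y) + (2 + y)
    idx₆ = ℕSolver.solve-∀
    idx₄ : ∀ y → 4 + (y + y) ≡ (4 + y) + (0 + y)
    idx₄ = ℕSolver.solve-∀
  middle : 0ℤ ≤ᶻ act (qint 5) f (dbl n)
  middle = subst (0ℤ ≤ᶻ_) (sym (regroup (f (6 + dy)) (f (5 + dy)) (f (4 + dy)) (f (3 + dy)) (f (2 + dy))))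
    (ℤP.+-mono-≤ (subst (0ℤ ≤ᶻ_) (sym paired) (F64≥0 y))
      (ℤP.+-mono-≤ (f≥0 (5 + dy) ℕP.≤-refl) (ℤP.+-mono-≤ (f≥0 (3 + dy) (ℕP.m≤n+m _ 2)) (f≥0 (2 + dy) (ℕP.m≤n+m _ 3)))))
  main : 0ℤ ≤ᶻ act (qint 5) f (2 + t)
  main with ℕP.m≤n⇒m<n∨m≡n le
  ... | inj₁ lt = act-qint-nonneg 5 f (2 + t) (λ x xle → f≥0 x (ℕP.≤-trans (s≤s xle) lt))
  ... | inj₂ e = subst (λ z → 0ℤ ≤ᶻ act (qint 5) f z) (sym e) middle

Goal : ℕ → ℕ → Set
Goal d n = Σ Poly λ P →
  (P *ₚ (qint (5 + n) *ₚ (qfact 5 *ₚ qfact n)) ≈ₚ (qint d *ₚ qfact (5 + n)))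
  × Normalized P
  × UnimodalParity P

Poch-at-0 : ∀ n k f → Poch n k f 0 ≡ f 0
Poch-at-0 n zero f = refl
Poch-at-0 n (suc k) f = trans (cong (Poch n k f 0 -ᶻ_) (sh-lo (n + suc k) _ 0 (ℕP.≤-trans (s≤s z≤n) (ℕP.m≤n+m (suc k) n))))
  (trans (ℤP.+-identityʳ _) (Poch-at-0 n k f))

cSer-at-0 : ∀ e n → cSer (suc e) n 0 ≡ 1ℤ
cSer-at-0 e n = Poch-at-0 n 4 [ suc e ]δ

cSer-goal : ∀ e n K → let D = dbl (dbl K) in
  numerDeg e n ≡ 14 + D → Supp D (cSer (suc e) n) →
  (∀ t → 2 + t ≤ dbl K → cSer (suc e) n t ≤ᶻ cSer (suc e) n (2 + t)) → Goal (suc e) n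
cSer-goal e n K deg sp up = P , cSer-identity (suc e) n P (coeff-mk D c sp) , normalized
                              , palindrome-unimodal K c pal up
  where
  D = dbl (dbl K)
  c = cSer (suc e) n
  P = mkList (suc D) c
  pal : ∀ a b → a + b ≡ D → c a ≡ c b
  pal = cSer-palindromic e n D deg sp
  normalized : Normalized P
  normalized = norm-mk D c (λ top → 1≢0 (trans (sym (cSer-at-0 e n)) (trans (pal 0 D refl) top)))
    where
    1≢0 : ¬ (1ℤ ≡ 0ℤ)
    1≢0 ()

-- The case 5 ∣ n: c is the Gaussian binomial [n+4 choose 4]

Poch-cong : ∀ n k {f g} → f ≗ g → Poch n k f ≗ Poch n k g
Poch-cong n zero e = e
Poch-cong n (suc k) e = N-cong (n + suc k) (Poch-cong n k e)

Den-N1 : ∀ f → Den (N 1 f) ≗ N 1 (Den f)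
Den-N1 f = N-cong 5 (N-cong 4 (N-cong 3 (N-comm 2 1 f) ∙ N-comm 3 1 (N 2 f)) ∙ N-comm 4 1 (N 3 (N 2 f)))
         ∙ N-comm 5 1 (N 4 (N 3 (N 2 f)))

-- Both are (q^{n+1};q)_4 (1 − q^5) after multiplication by (1 − q)·Den.
cSer5-gauss : ∀ n → cSer 5 n ≗ gauss n 4
cSer5-gauss n = N-inj 0 _ _ (Den-inj _ _ (lhs ∙ ~ rhs))
  where
  lhs : Den (N 1 (cSer 5 n)) ≗ Poch n 4 (N 5 δ)
  lhs = Den-N1 (cSer 5 n) ∙ N-cong 1 (Den-cSer 5 n) ∙ ~ Poch-N n 4 1 [ 5 ]δ ∙ Poch-cong n 4 (N1-qint 5 δ)
  rhs : Den (N 1 (gauss n 4)) ≗ Poch n 4 (N 5 δ)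
  rhs = N-cong 5 (Poch-divPoch 4 (Poch n 4 δ)) ∙ ~ Poch-N n 4 5 δ

goal-multiple : ∀ y → Goal 5 (3 + y)
goal-multiple y = cSer-goal 4 n n (deg y) sp (cSer5-increasing y)
  where
  n = 3 + y
  deg : ∀ y → numerDeg 4 (3 + y) ≡ 14 + dbl (dbl (3 + y))
  deg y = trans (arith y) (cong (λ z → 14 + z) (sym (dbl-dbl≡ (3 + y))))
    where
    arith : ∀ y → ((3 + y) + 4) + (((3 + y) + 3) + (((3 + y) + 2) + (((3 + y) + 1) + 4)))
                  ≡ 14 + (((3 + y) + (3 + y)) + ((3 + y) + (3 + y)))
    arith = ℕSolver.solve-∀
  sp : Supp (dbl (dbl n)) (cSer 5 n)
  sp = Supp-cong (~ cSer5-gauss n)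
    (Supp-reindex (trans (four n) (sym (dbl-dbl≡ n))) (Supp-gauss n 4))
    where
    four : ∀ n → n * 4 ≡ (n + n) + (n + n)
    four = ℕSolver.solve-∀

-- The case 5 ∤ n: c = (1 − q)·[n+4 choose 4]/(1 − q^5) is a polynomial

fold5 : Series → Series
fold5 v 0 = v 0
fold5 v 1 = v 1
fold5 v 2 = v 2
fold5 v 3 = v 3
fold5 v 4 = v 4
fold5 v (suc (suc (suc (suc (suc j))))) = fold5 v j

fold5-periodic : ∀ v → (∀ j → v (5 + j) ≡ v j) → v ≗ fold5 v
fold5-periodic v per = periodic-induction (λ j → v j ≡ fold5 v j) 4 0 base (λ w h → trans (per w) h)
  where
  base : ∀ j → j < 5 → v j ≡ fold5 v j
  base 0 _ = refl
  base 1 _ = refl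
  base 2 _ = refl
  base 3 _ = refl
  base 4 _ = refl
  base (suc (suc (suc (suc (suc j))))) (s≤s (s≤s (s≤s (s≤s (s≤s ())))))

window : Series → ℕ → ℤ
window v x = v x +ᶻ (v (1 + x) +ᶻ (v (2 + x) +ᶻ (v (3 + x) +ᶻ v (4 + x))))

-- On 5-periodic sequences, (1−q)(1−q^2)(1−q^3)(1−q^4) acts as 5 − [5]
-- (it is 5 at the primitive fifth roots of unity, 0 at 1).
Poch04-periodic : ∀ v → (∀ j → v (5 + j) ≡ v j) → Poch 0 4 v 10 ≡ (+ 5) *ᶻ v 0 -ᶻ window v 0
Poch04-periodic v per = trans (Poch-cong 0 4 (fold5-periodic v per) 10) (ring (v 0) (v 1) (v 2) (v 3) (v 4))
  where
  ring : ∀ a0 a1 a2 a3 a4 →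
    ((((a0 -ᶻ a4) -ᶻ (a3 -ᶻ a2)) -ᶻ ((a2 -ᶻ a1) -ᶻ (a0 -ᶻ a4))) -ᶻ
     (((a1 -ᶻ a0) -ᶻ (a4 -ᶻ a3)) -ᶻ ((a3 -ᶻ a2) -ᶻ (a1 -ᶻ a0))))
    ≡ (+ 5) *ᶻ a0 -ᶻ (a0 +ᶻ (a1 +ᶻ (a2 +ᶻ (a3 +ᶻ a4))))
  ring = solve-∀

constant-tail : ∀ H b → (∀ i → H (5 + (i + b)) ≡ H (i + b)) → (∀ i → Poch 0 4 H (10 + (i + b)) ≡ 0ℤ) →
  ∀ i → H (i + b) ≡ H b
constant-tail H b per kill i = ℤP.*-cancelˡ-≡ (+ 5) _ _ (trans (five-times i) (sym (five-times 0)))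
  where
  per′ : ∀ i j → H (5 + (j + (i + b))) ≡ H (j + (i + b))
  per′ i j = trans (cong (λ x → H (5 + x)) (sym (ℕP.+-assoc j i b))) (trans (per (j + i)) (cong H (ℕP.+-assoc j i b)))
  -- 5·H(i + b) equals the window sum at i + b, …
  at : ∀ i → (+ 5) *ᶻ H (i + b) -ᶻ window H (i + b) ≡ 0ℤ
  at i = trans (sym (Poch04-periodic (λ j → H (j + (i + b))) (per′ i))) (kill i)
  -- … which does not depend on i.
  window-const : ∀ i → window H (i + b) ≡ window H b
  window-const zero = refl
  window-const (suc i) = trans (lem (H (1 + (i + b))) (H (2 + (i + b))) (H (3 + (i + b))) (H (4 + (i + b))) (per i))
                               (window-const i)
    where
    lem : ∀ a1 a2 a3 a4 → H (5 + (i + b)) ≡ H (i + b) →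
      a1 +ᶻ (a2 +ᶻ (a3 +ᶻ (a4 +ᶻ H (5 + (i + b))))) ≡ H (i + b) +ᶻ (a1 +ᶻ (a2 +ᶻ (a3 +ᶻ a4)))
    lem a1 a2 a3 a4 e = trans (cong (λ z → a1 +ᶻ (a2 +ᶻ (a3 +ᶻ (a4 +ᶻ z)))) e) (rot a1 a2 a3 a4 (H (i + b)))
      where
      rot : ∀ a1 a2 a3 a4 a0 → a1 +ᶻ (a2 +ᶻ (a3 +ᶻ (a4 +ᶻ a0))) ≡ a0 +ᶻ (a1 +ᶻ (a2 +ᶻ (a3 +ᶻ a4)))
      rot = solve-∀
  five-times : ∀ i → (+ 5) *ᶻ H (i + b) ≡ window H b
  five-times i = trans (ℤP.i-j≡0⇒i≡j _ _ (at i)) (window-const i)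

geom5 : ℕ → Series → Series
geom5 zero g = zeroS
geom5 (suc l) g = g ⊕ sh 5 (geom5 l g)

N5-geom5 : ∀ l g → N 5 (geom5 l g) ≗ N (l * 5) g
N5-geom5 zero g m = trans (cong (0ℤ -ᶻ_) (sh-zeroS 5 m)) (sym (ℤP.+-inverseʳ (g m)))
N5-geom5 (suc l) g = N-⊕ 5 g (sh 5 (geom5 l g))
  ∙ ⊕-cong (≗refl {N 5 g}) (~ sh-N 5 5 (geom5 l g) ∙ sh-cong 5 (N5-geom5 l g))
  ∙ ~ (N-congk g (ℕP.+-comm 5 (l * 5)) ∙ N-+ (l * 5) 5 g)

Supp-geom5 : ∀ l {B g} → Supp B g → Supp (l * 5 + B) (geom5 l g)
Supp-geom5 zero sp m _ = refl
Supp-geom5 (suc l) {B} sp = Supp-⊕ (Supp-mono (ℕP.m≤n+m B (suc l * 5)) sp) (Supp-sh 5 (Supp-geom5 l sp))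

Supp-G5-N : ∀ a l {B g} → a ≡ l * 5 → Supp B g → Supp (a + B) (G 5 (N a g))
Supp-G5-N a l {B} {g} refl sp = Supp-cong (~ (G-cong 4 (~ N5-geom5 l g) ∙ GN 4 (geom5 l g))) (Supp-geom5 l sp)

-- Hence so is (q^{n+1};q)_4 / (1 − q^5) when 5 ∣ n + r, 1 ≤ r ≤ 4: bring the
-- factor 1 − q^{n+r} to the front.
Supp-G5-Poch : ∀ n r l → n + r ≡ l * 5 → 1 ≤ r → r ≤ 4 → Supp (n * 4 + 10) (G 5 (Poch n 4 δ))
Supp-G5-Poch n 1 l eq _ _ = Supp-cong (G-cong 4 (~ perm)) (Supp-reindex (arith n) (Supp-G5-N (n + 1) l eq
    (Supp-N (n + 4) (Supp-N (n + 3) (Supp-N (n + 2) Supp-δ)))))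
  where
  perm : Poch n 4 δ ≗ N (n + 1) (N (n + 4) (N (n + 3) (N (n + 2) δ)))
  perm = N-cong (n + 4) (N-cong (n + 3) (N-comm (n + 2) (n + 1) δ) ∙ N-comm (n + 3) (n + 1) (N (n + 2) δ)) ∙ N-comm (n + 4) (n + 1) (N (n + 3) (N (n + 2) δ))
  arith : ∀ n → (n + 1) + ((n + 4) + ((n + 3) + ((n + 2) + 0))) ≡ n * 4 + 10
  arith = ℕSolver.solve-∀
Supp-G5-Poch n 2 l eq _ _ = Supp-cong (G-cong 4 (~ perm)) (Supp-reindex (arith n) (Supp-G5-N (n + 2) l eq
    (Supp-N (n + 4) (Supp-N (n + 3) (Supp-N (n + 1) Supp-δ)))))
  where
  perm : Poch n 4 δ ≗ N (n + 2) (N (n + 4) (N (n + 3) (N (n + 1) δ)))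
  perm = N-cong (n + 4) (N-comm (n + 3) (n + 2) (N (n + 1) δ)) ∙ N-comm (n + 4) (n + 2) (N (n + 3) (N (n + 1) δ))
  arith : ∀ n → (n + 2) + ((n + 4) + ((n + 3) + ((n + 1) + 0))) ≡ n * 4 + 10
  arith = ℕSolver.solve-∀
Supp-G5-Poch n 3 l eq _ _ = Supp-cong (G-cong 4 (~ perm)) (Supp-reindex (arith n) (Supp-G5-N (n + 3) l eq
    (Supp-N (n + 4) (Supp-N (n + 2) (Supp-N (n + 1) Supp-δ)))))
  where
  perm : Poch n 4 δ ≗ N (n + 3) (N (n + 4) (N (n + 2) (N (n + 1) δ)))
  perm = N-comm (n + 4) (n + 3) (N (n + 2) (N (n + 1) δ))
  arith : ∀ n → (n + 3) + ((n + 4) + ((n + 2) + ((n + 1) + 0))) ≡ n * 4 + 10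
  arith = ℕSolver.solve-∀
Supp-G5-Poch n 4 l eq _ _ = Supp-reindex (arith n) (Supp-G5-N (n + 4) l eq
    (Supp-N (n + 3) (Supp-N (n + 2) (Supp-N (n + 1) Supp-δ))))
  where
  arith : ∀ n → (n + 4) + ((n + 3) + ((n + 2) + ((n + 1) + 0))) ≡ n * 4 + 10
  arith = ℕSolver.solve-∀
Supp-G5-Poch n (suc (suc (suc (suc (suc r))))) l eq _ (s≤s (s≤s (s≤s (s≤s ()))))

tailSer : ℕ → Series
tailSer n = G 5 (gauss n 4)

cSer1-tail : ∀ n → cSer 1 n ≗ N 1 (tailSer n)
cSer1-tail n = N-inj 0 _ _ (Den-inj _ _ (lhs ∙ ~ rhs))
  where
  lhs : Den (N 1 (cSer 1 n)) ≗ Poch n 4 (N 1 δ)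
  lhs = Den-N1 (cSer 1 n) ∙ N-cong 1 (Den-cSer 1 n) ∙ ~ Poch-N n 4 1 [ 1 ]δ ∙ Poch-cong n 4 (N1-qint 1 δ)
  rhs : Den (N 1 (N 1 (tailSer n))) ≗ Poch n 4 (N 1 δ)
  rhs = Poch-N 0 5 1 (tailSer n)
      ∙ N-cong 1 (N-cong 5 (Poch-G 0 4 4 (gauss n 4)) ∙ NG 4 _ ∙ Poch-divPoch 4 (Poch n 4 δ))
      ∙ ~ Poch-N n 4 1 δ

tailSer-periodic : ∀ n w → n * 4 < 5 + w → tailSer n (5 + w) ≡ tailSer n w
tailSer-periodic n w lt = trans (G-eq 4 (gauss n 4) (5 + w))
  (trans (cong (_+ᶻ tailSer n w) (Supp-gauss n 4 (5 + w) lt)) (ℤP.+-identityˡ _))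

Poch04-tailSer : ∀ n → Poch 0 4 (tailSer n) ≗ G 5 (Poch n 4 δ)
Poch04-tailSer n = Poch-G 0 4 4 (gauss n 4) ∙ G-cong 4 (Poch-divPoch 4 (Poch n 4 δ))

-- If (q^{n+1};q)_4 / (1 − q^5) is a polynomial (of degree ≤ 4n + 10), tailSer is
-- eventually constant, so c has degree ≤ 4n + 1 = D + 5, hence ≤ D.
goal-coprime : ∀ n' → Supp (suc n' * 4 + 10) (G 5 (Poch (suc n') 4 δ)) → Goal 1 (suc n')
goal-coprime n' kdeg = cSer-goal 0 n n' deg sp (cSer1-increasing n')
  where
  n = suc n'
  D = dbl (dbl n')
  H = tailSer n
  b = n * 4 + 1
  deg : numerDeg 0 n ≡ 14 + D
  deg = trans (arith n') (cong (λ z → 14 + z) (sym (dbl-dbl≡ n')))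
    where
    arith : ∀ n' → (suc n' + 4) + ((suc n' + 3) + ((suc n' + 2) + ((suc n' + 1) + 0))) ≡ 14 + ((n' + n') + (n' + n'))
    arith = ℕSolver.solve-∀
  below-b : ∀ i k → n * 4 + k < k + (i + b)
  below-b i k = subst (_< k + (i + b)) (ℕP.+-comm k (n * 4))
    (ℕP.+-monoʳ-< k (ℕP.<-≤-trans (ℕP.m<m+n (n * 4) (s≤s z≤n)) (ℕP.m≤n+m b i)))
  constant : ∀ i → H (i + b) ≡ H b
  constant = constant-tail H b
    (λ i → tailSer-periodic n (i + b) (ℕP.≤-<-trans (ℕP.m≤m+n (n * 4) 5) (below-b i 5)))
    (λ i → trans (Poch04-tailSer n (10 + (i + b))) (kdeg _ (below-b i 10)))
  supp-b : Supp b (cSer 1 n)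
  supp-b m lt with split (suc b) m
  ... | inj₁ m<sb = ⊥-elim (ℕP.<-irrefl refl (ℕP.<-≤-trans lt (ℕP.≤-pred m<sb)))
  ... | inj₂ (j , refl) = trans (cSer1-tail n (suc (b + j)))
        (trans (cong₂ (λ x y → H (suc x) -ᶻ H y) (ℕP.+-comm b j) (ℕP.+-comm b j))
        (trans (cong₂ _-ᶻ_ (constant (suc j)) (constant j)) (ℤP.+-inverseʳ (H b))))
  sp : Supp D (cSer 1 n)
  sp = Den-degree D 5 (cSer 1 n) (Supp-reindex (arith n') supp-b) (Supp-Den-cSer 0 n D deg)
    where
    arith : ∀ n' → suc n' * 4 + 1 ≡ 5 + dbl (dbl n')
    arith n' = trans (lin n') (cong (λ z → 5 + z) (sym (dbl-dbl≡ n')))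
      where
      lin : ∀ n' → suc n' * 4 + 1 ≡ 5 + ((n' + n') + (n' + n'))
      lin = ℕSolver.solve-∀

gcd5-divisible : ∀ n → 5 ∣ n → gcd 5 n ≡ 5
gcd5-divisible n 5∣n = ∣-antisym (gcd[m,n]∣m 5 n) (gcd-greatest ∣-refl 5∣n)

gcd5-coprime : ∀ n → ¬ 5 ∣ n → gcd 5 n ≡ 1
gcd5-coprime n 5∤n with prime⇒irreducible prime5 (gcd[m,n]∣m 5 n)
  where
  prime5 : Prime 5
  prime5 = toWitness {a? = prime? 5} tt
... | inj₁ e = e
... | inj₂ e = ⊥-elim (5∤n (subst (_∣ n) e (gcd[m,n]∣n 5 n)))

complete-to-5 : ∀ r r' q {n} → n ≡ r + q * 5 → r + r' ≡ 5 → n + r' ≡ suc q * 5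
complete-to-5 r r' q e s = trans (cong (_+ r') e) (trans (rearrange r r' (q * 5)) (cong (_+ q * 5) s))
  where
  rearrange : ∀ a b c → (a + c) + b ≡ (a + b) + c
  rearrange = ℕSolver.solve-∀

-- If 5 ∤ n, then 5 divides n + r for r = 5 − (n mod 5) ∈ [1, 4].
coprime-kernel : ∀ n → ¬ 5 ∣ n → Supp (n * 4 + 10) (G 5 (Poch n 4 δ))
coprime-kernel n 5∤n with n % 5 | m≡m%n+[m/n]*n n 5 | m%n<n n 5
... | 0 | e | _ = ⊥-elim (5∤n (divides (n / 5) e))
... | 1 | e | _ = Supp-G5-Poch n 4 (suc (n / 5)) (complete-to-5 1 4 (n / 5) e refl) (s≤s z≤n) ℕP.≤-refl
... | 2 | e | _ = Supp-G5-Poch n 3 (suc (n / 5)) (complete-to-5 2 3 (n / 5) e refl) (s≤s z≤n) (ℕP.n≤1+n 3)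
... | 3 | e | _ = Supp-G5-Poch n 2 (suc (n / 5)) (complete-to-5 3 2 (n / 5) e refl) (s≤s z≤n) (s≤s (s≤s z≤n))
... | 4 | e | _ = Supp-G5-Poch n 1 (suc (n / 5)) (complete-to-5 4 1 (n / 5) e refl) ℕP.≤-refl (s≤s z≤n)
... | suc (suc (suc (suc (suc r)))) | _ | s≤s (s≤s (s≤s (s≤s (s≤s ()))))

proposition9 : (n : ℕ) → 1 ≤ n →
    Σ Poly λ P →
    (P *ₚ (qint (5 + n) *ₚ (qfact 5 *ₚ qfact n)) ≈ₚ (qint (gcd 5 n) *ₚ qfact (5 + n)))
    × Normalized P
    × UnimodalParity P
proposition9 (suc n') _ with 5 ∣? suc n'
... | yes 5∣n with ℕP.m≤n⇒∃[o]m+o≡n (ℕP.≤-trans (ℕP.n≤1+n 3) (ℕP.≤-trans (ℕP.n≤1+n 4) (∣⇒≤ 5∣n)))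
...   | y , refl = subst (λ d → Goal d (3 + y)) (sym (gcd5-divisible (3 + y) 5∣n)) (goal-multiple y)
proposition9 (suc n') _ | no 5∤n =
  subst (λ d → Goal d (suc n')) (sym (gcd5-coprime (suc n') 5∤n)) (goal-coprime n' (coprime-kernel (suc n') 5∤n))
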